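{- Let $k\ge1$ be an integer. For every $N$ there is a $k$-special sequence of length at least $N$ whose entries come from a set of $3k+1$ symbols.
   Context: For a (finite or infinite) sequence $S=s_1,s_2,\dots$ and integer $k\ge1$, a sequence of indices $i_1,\dots,i_{2r}$ ($r\ge1$) is $k$-bad for $S$ if there is $m$ with $1<m\le 2r$ such that: (a) $s_{i_j}=s_{i_{j+r}}$ for $1\le j\le r$; (b) $i_1>i_2>\dots>i_m<i_{m+1}<\dots<i_{2r}$; (c) $|i_j-i_{j+1}|\le k$ for $1\le j<2r$; (d) $i_{m+1}<i_m+k$ if $m<2r$. $S$ is $k$-special if it has no $k$-bad sequence of indices. -}

module Defs where

open import Data.Nat using (ℕ; suc; _+_; _*_; _≤_; _<_; _>_)
open import Data.Fin using (Fin; toℕ)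
open import Data.Product using (Σ; _×_; ∃-syntax)
open import Relation.Binary.PropositionalEquality using (_≡_)
open import Relation.Nullary using (¬_)

-- Absolute difference bound |a - b| ≤ k, stated without subtraction.
_≈⟨_⟩_ : ℕ → ℕ → ℕ → Set
a ≈⟨ k ⟩ b = (a ≤ b + k) × (b ≤ a + k)

-- A finite sequence S of length n over alphabet A is a function Fin n → A,
-- with position p : Fin n corresponding to the paper's index toℕ p + 1.
-- A sequence of indices i_1,…,i_{2r} is a function i : ℕ → Fin n, of which
-- only the values at 1,…,2r are used (paper's 1-based j).
-- The indices are compared via toℕ (a uniform shift by one is irrelevant).
IsKBad : {A : Set} {n : ℕ} → ℕ → (Fin n → A) → (r : ℕ) → (ℕ → Fin n) → Set
IsKBad {n = n} k S r i =
  (1 ≤ r) ×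
  ∃[ m ] ((1 < m) × (m ≤ 2 * r)
    × (∀ j → 1 ≤ j → j ≤ r → S (i j) ≡ S (i (j + r)))
    × (∀ j → 1 ≤ j → j < m → toℕ (i j) > toℕ (i (suc j)))
    × (∀ j → m ≤ j → j < 2 * r → toℕ (i j) < toℕ (i (suc j)))
    × (∀ j → 1 ≤ j → j < 2 * r → toℕ (i j) ≈⟨ k ⟩ toℕ (i (suc j)))
    × (m < 2 * r → toℕ (i (suc m)) < toℕ (i m) + k))

HasKBad : {A : Set} {n : ℕ} → ℕ → (Fin n → A) → Set
HasKBad k S = ∃[ r ] ∃[ i ] IsKBad k S r i

KSpecial : {A : Set} {n : ℕ} → ℕ → (Fin n → A) → Set
KSpecial k S = ¬ HasKBad k S

module Submission where

open import Defs
open import Data.Bool using (Bool; true; false; not; _xor_)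
open import Data.Bool.Properties using (not-involutive; not-injective; not-¬; ¬-not) renaming (_≟_ to _≟ᵇ_)
open import Data.Empty using (⊥; ⊥-elim)
open import Data.Fin using (Fin; toℕ; fromℕ<)
open import Data.Fin.Properties using (fromℕ<-injective)
open import Data.Nat
open import Data.Nat.Induction using (<-rec)
open import Data.Nat.Properties
open import Algebra.Properties.CommutativeSemigroup +-commutativeSemigroup using (xy∙z≈xz∙y; xy∙z≈yx∙z; x∙yz≈xz∙y)
open import Data.Nat.Tactic.RingSolver using (solve-∀)
open import Data.Product
open import Data.Sum using (_⊎_; inj₁; inj₂)
open import Data.Unit using (⊤; tt)
open import Relation.Binary.Definitions using (tri<; tri≈; tri>)
open import Relation.Binary.PropositionalEquality
open import Relation.Nullary using (¬_; yes; no)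

-- Let w be a square-free word over {0, 1, 2}; the first differences of the Thue–Morse word form one,
-- because the Thue–Morse word has no overlaps.  Cut ℕ into blocks of length 2k+1 along which the height
-- runs 0, 1, …, k, k, …, 1.  A position of height ρ ≥ 1 in the rising (falling) half of block t gets the
-- symbol (ρ, w (2t)) (resp. (ρ, w (2t+1))) and height 0 is a separator, which makes 3k+1 symbols.
-- In a k-bad sequence compare the steps i_j → i_{j+1} and i_{j+r} → i_{j+r+1}: equal symbols have equal
-- heights and letters, and since neighbouring letters of w differ, both steps have the same length and
-- sit alike in the blocks.  Where the walk turns, this puts one letter on two adjacent half-blocks or two
-- equal symbols within distance 2k; if it never turns, the second half is the first one shifted by a
-- multiple of the block length, and the letters it meets form a square in w.

-- A square-free word over three letters

SquareFree : {A : Set} → (ℕ → A) → Set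
SquareFree w = ∀ i L → 1 ≤ L → ¬ (∀ j → j < L → w (i + j) ≡ w (i + L + j))

even⊎odd : ∀ n → ∃[ m ] (n ≡ m + m ⊎ n ≡ suc (m + m))
even⊎odd zero = 0 , inj₁ refl
even⊎odd (suc n) with even⊎odd n
... | m , inj₁ refl = m , inj₂ refl
... | m , inj₂ refl = suc m , inj₁ (cong suc (sym (+-suc m m)))

odd : ℕ → Bool
odd zero    = false
odd (suc n) = not (odd n)

odd-double : ∀ m → odd (m + m) ≡ false
odd-double zero    = refl
odd-double (suc m) rewrite +-suc m m = trans (not-involutive _) (odd-double m)

-- With fuel f ≥ n, thueMorseᶠ f n is the parity of the binary digit sum of n.
thueMorseᶠ : ℕ → ℕ → Bool
thueMorseᶠ zero    n = false
thueMorseᶠ (suc f) n = odd n xor thueMorseᶠ f ⌊ n /2⌋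

thueMorse : ℕ → Bool
thueMorse n = thueMorseᶠ n n

⌊n/2⌋≤pred : ∀ {n f} → n ≤ suc f → ⌊ n /2⌋ ≤ f
⌊n/2⌋≤pred {zero}  _   = z≤n
⌊n/2⌋≤pred {suc n} n≤f = ≤-pred (≤-trans (⌊n/2⌋<n n) n≤f)

thueMorseᶠ-fuel : ∀ {f g n} → n ≤ f → n ≤ g → thueMorseᶠ f n ≡ thueMorseᶠ g n
thueMorseᶠ-fuel {zero}  {zero}  _   _   = refl
thueMorseᶠ-fuel {zero}  {suc g} z≤n _   = thueMorseᶠ-fuel {zero} {g} z≤n z≤n
thueMorseᶠ-fuel {suc f} {zero}  _   z≤n = thueMorseᶠ-fuel {f} {zero} z≤n z≤n
thueMorseᶠ-fuel {suc f} {suc g} {n} n≤f n≤g =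
  cong (odd n xor_) (thueMorseᶠ-fuel (⌊n/2⌋≤pred n≤f) (⌊n/2⌋≤pred n≤g))

thueMorse-unfold : ∀ n → thueMorse n ≡ odd n xor thueMorse ⌊ n /2⌋
thueMorse-unfold zero    = refl
thueMorse-unfold (suc n) =
  cong (odd (suc n) xor_) (thueMorseᶠ-fuel {n} (⌊n/2⌋≤pred ≤-refl) ≤-refl)

thueMorse-double : ∀ m → thueMorse (m + m) ≡ thueMorse m
thueMorse-double m = begin
  thueMorse (m + m)                          ≡⟨ thueMorse-unfold (m + m) ⟩
  odd (m + m) xor thueMorse ⌊ m + m /2⌋      ≡⟨ cong₂ (λ b n → b xor thueMorse n) (odd-double m) (sym (n≡⌊n+n/2⌋ m)) ⟩
  thueMorse m                                ∎
  where open ≡-Reasoning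

thueMorse-double+1 : ∀ m → thueMorse (suc (m + m)) ≡ not (thueMorse m)
thueMorse-double+1 m = begin
  thueMorse (suc (m + m))                              ≡⟨ thueMorse-unfold (suc (m + m)) ⟩
  not (odd (m + m)) xor thueMorse ⌈ m + m /2⌉          ≡⟨ cong₂ (λ b n → not b xor thueMorse n) (odd-double m)
      (sym (n≡⌈n+n/2⌉ m)) ⟩
  not (thueMorse m)                                    ∎
  where open ≡-Reasoning

private
  t = thueMorse

  ≢-≢⇒≡ : ∀ {a b c : Bool} → a ≢ b → b ≢ c → a ≡ c
  ≢-≢⇒≡ a≢b b≢c = trans (¬-not a≢b) (sym (¬-not (λ c≡b → b≢c (sym c≡b))))

Alternates : ℕ → Set
Alternates y = thueMorse y ≢ thueMorse (suc y)

thueMorse-alternates-at-even : ∀ m → Alternates (m + m)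
thueMorse-alternates-at-even m eq =
  not-¬ refl (trans (sym (thueMorse-double m)) (trans eq (thueMorse-double+1 m)))

thueMorse-no-three-equal : ∀ n → t n ≡ t (suc n) → t (suc n) ≢ t (suc (suc n))
thueMorse-no-three-equal n e₁ e₂ with even⊎odd n
... | m , inj₁ refl = thueMorse-alternates-at-even m e₁
... | m , inj₂ refl = thueMorse-alternates-at-even (suc m) (subst (λ z → t z ≡ t (suc z)) (sym (+-suc (suc m) m)) e₂)

thueMorse-not-four-alternations : ∀ c → ¬ (∀ u → u ≤ 3 → Alternates (u + (c + c)))
thueMorse-not-four-alternations c alt =
  thueMorse-no-three-equal c
    (trans (sym (thueMorse-double c))
        (trans (≢-≢⇒≡ (alt 0 z≤n) (alt 1 (s≤s z≤n))) (trans (cong t (2c+2 c)) (thueMorse-double (suc c)))))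
    (trans (sym (thueMorse-double (suc c))) (trans (cong t (sym (2c+2 c)))
      (trans (≢-≢⇒≡ (alt 2 (s≤s (s≤s z≤n))) (alt 3 ≤-refl)) (trans (cong t 2c+4) (thueMorse-double (suc (suc c)))))))
  where
    2c+2 : ∀ c → 2 + (c + c) ≡ suc c + suc c
    2c+2 c = cong suc (sym (+-suc c c))
    2c+4 : 4 + (c + c) ≡ suc (suc c) + suc (suc c)
    2c+4 = trans (cong (2 +_) (2c+2 c)) (2c+2 (suc c))

Overlap : ℕ → ℕ → Set
Overlap i p = ∀ j → j ≤ p → thueMorse (i + j) ≡ thueMorse (i + j + p)

overlap-at : ∀ {i p y} → Overlap i p → i ≤ y → y ≤ i + p → t y ≡ t (y + p)
overlap-at {i} {p} {y} ov i≤y y≤i+p =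
  subst (λ z → t z ≡ t (z + p)) (m+[n∸m]≡n i≤y) (ov (y ∸ i) (∸-le))
  where
    ∸-le : y ∸ i ≤ p
    ∸-le = ≤-trans (∸-monoˡ-≤ i y≤i+p) (≤-reflexive (m+n∸m≡n i p))

overlap-odd-alternates₂ : ∀ {i} q → Overlap i (suc (q + q)) →
                         ∀ y → i ≤ y → y < i + suc (q + q) → Alternates y × Alternates (y + suc (q + q))
overlap-odd-alternates₂ {i} q ov y i≤y y<i+p with even⊎odd y
... | m , inj₁ refl = alt , λ e → alt (trans e₀ (trans e (sym e₁)))
  where alt = thueMorse-alternates-at-even m
        e₀ = overlap-at ov i≤y (<⇒≤ y<i+p)
        e₁ = overlap-at ov (m≤n⇒m≤1+n i≤y) y<i+p
... | m , inj₂ refl = (λ e → alt (trans (sym e₀) (trans e e₁))) , alt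
  where odd+odd : ∀ m q → suc (m + m) + suc (q + q) ≡ suc (m + q) + suc (m + q)
        odd+odd = solve-∀
        alt = subst Alternates (sym (odd+odd m q)) (thueMorse-alternates-at-even (suc (m + q)))
        e₀ = overlap-at ov i≤y (<⇒≤ y<i+p)
        e₁ = overlap-at ov (m≤n⇒m≤1+n i≤y) y<i+p

overlap-odd-alternates : ∀ {i} q → Overlap i (suc (q + q)) →
                         ∀ y → i ≤ y → y < i + suc (q + q) + suc (q + q) → Alternates y
overlap-odd-alternates {i} q ov y i≤y y<i+2p with y <? i + p
  where p = suc (q + q)
... | yes y<i+p = proj₁ (overlap-odd-alternates₂ q ov y i≤y y<i+p)
... | no  y≮i+p = subst Alternates z+p≡y (proj₂ (overlap-odd-alternates₂ q ov z i≤z z<i+p))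
  where
    p = suc (q + q)
    z = y ∸ p
    z+p≡y : z + p ≡ y
    z+p≡y = m∸n+n≡m (≤-trans (m≤n+m p i) (≮⇒≥ y≮i+p))
    i≤z : i ≤ z
    i≤z = +-cancelʳ-≤ p i z (subst (i + p ≤_) (sym z+p≡y) (≮⇒≥ y≮i+p))
    z<i+p : z < i + p
    z<i+p = +-cancelʳ-< p z (i + p) (subst (_< i + p + p) (sym z+p≡y) y<i+2p)

even-near : ∀ i → ∃[ c ] (i ≤ c + c × c + c ≤ suc i)
even-near i with even⊎odd i
... | m , inj₁ refl = m , ≤-refl , n≤1+n _
... | m , inj₂ refl = suc m , ≤-trans (n≤1+n _) (≤-reflexive (sym 2m+2)) , ≤-reflexive 2m+2
  where 2m+2 = cong suc (+-suc m m)

thueMorse-no-odd-overlap : ∀ q i → ¬ Overlap i (suc (q + q))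
thueMorse-no-odd-overlap zero i ov =
  proj₁ (overlap-odd-alternates₂ 0 ov i ≤-refl (m<m+n i z<s))
    (subst₂ (λ a b → t a ≡ t b) (+-identityʳ i) (trans (+-comm (i + 0) 1) (cong suc (+-identityʳ i))) (ov 0 z≤n))
thueMorse-no-odd-overlap (suc q) i ov with even-near i
... | c , i≤2c , 2c≤1+i = thueMorse-not-four-alternations c λ u u≤3 →
        overlap-odd-alternates (suc q) ov (u + (c + c)) (≤-trans i≤2c (m≤n+m _ u))
          (<-≤-trans (s≤s (+-mono-≤ u≤3 2c≤1+i)) window-fits)
  where
    window-fits : 5 + i ≤ i + suc (suc q + suc q) + suc (suc q + suc q)
    window-fits = subst (5 + i ≤_) (sym (rearrange i q)) (m≤m+n (5 + i) _)
      where rearrange : ∀ i q → i + suc (suc q + suc q) + suc (suc q + suc q) ≡ 5 + i + suc (q + q + (q + q))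
            rearrange = solve-∀

overlap-halve : ∀ a q → Overlap (a + a) (q + q) ⊎ Overlap (suc (a + a)) (q + q) → Overlap a q
overlap-halve a q (inj₁ ov) j j≤q = begin
  t (a + j)                      ≡⟨ sym (thueMorse-double (a + j)) ⟩
  t ((a + j) + (a + j))          ≡⟨ cong t (sym (e₁ a j)) ⟩
  t (a + a + (j + j))            ≡⟨ ov (j + j) (+-mono-≤ j≤q j≤q) ⟩
  t (a + a + (j + j) + (q + q))  ≡⟨ cong t (e₂ a j q) ⟩
  t ((a + j + q) + (a + j + q))  ≡⟨ thueMorse-double (a + j + q) ⟩
  t (a + j + q)                  ∎
  where open ≡-Reasoning
        e₁ : ∀ a j → a + a + (j + j) ≡ (a + j) + (a + j)
        e₁ = solve-∀
        e₂ : ∀ a j q → a + a + (j + j) + (q + q) ≡ (a + j + q) + (a + j + q)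
        e₂ = solve-∀
overlap-halve a q (inj₂ ov) j j≤q = not-injective (begin
  not (t (a + j))                        ≡⟨ sym (thueMorse-double+1 (a + j)) ⟩
  t (suc ((a + j) + (a + j)))            ≡⟨ cong t (sym (e₁ a j)) ⟩
  t (suc (a + a) + (j + j))              ≡⟨ ov (j + j) (+-mono-≤ j≤q j≤q) ⟩
  t (suc (a + a) + (j + j) + (q + q))    ≡⟨ cong t (e₂ a j q) ⟩
  t (suc ((a + j + q) + (a + j + q)))    ≡⟨ thueMorse-double+1 (a + j + q) ⟩
  not (t (a + j + q))                    ∎)
  where open ≡-Reasoning
        e₁ : ∀ a j → suc (a + a) + (j + j) ≡ suc ((a + j) + (a + j))
        e₁ = solve-∀
        e₂ : ∀ a j q → suc (a + a) + (j + j) + (q + q) ≡ suc ((a + j + q) + (a + j + q))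
        e₂ = solve-∀

-- An odd period p makes the word alternate on 2p consecutive positions, which its doubling rule forbids
-- (thueMorse (2m) ≡ thueMorse m turns four alternations into three equal bits); an even period halves.
thueMorse-overlapFree : ∀ p → 1 ≤ p → ∀ i → ¬ Overlap i p
thueMorse-overlapFree = <-rec _ go
  where
    go : ∀ p → (∀ {q} → q < p → 1 ≤ q → ∀ i → ¬ Overlap i q) → 1 ≤ p → ∀ i → ¬ Overlap i p
    go p rec 1≤p i ov with even⊎odd p | even⊎odd i
    ... | q , inj₂ refl | _ = thueMorse-no-odd-overlap q i ov
    ... | suc q , inj₁ refl | a , inj₁ refl = rec (m<m+n (suc q) (s≤s z≤n)) (s≤s z≤n) a
        (overlap-halve a (suc q) (inj₁ ov))
    ... | suc q , inj₁ refl | a , inj₂ refl = rec (m<m+n (suc q) (s≤s z≤n)) (s≤s z≤n) a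
        (overlap-halve a (suc q) (inj₂ ov))

-- With bits as 0/1 this is the letter 1 + b − a.
difference : Bool → Bool → ℕ
difference false false = 1
difference false true  = 2
difference true  false = 0
difference true  true  = 1

difference<3 : ∀ a b → difference a b < 3
difference<3 false false = s≤s (s≤s z≤n)
difference<3 false true  = ≤-refl
difference<3 true  false = s≤s z≤n
difference<3 true  true  = s≤s (s≤s z≤n)

difference-injectiveʳ : ∀ a {b d} → difference a b ≡ difference a d → b ≡ d
difference-injectiveʳ false {false} {false} _ = refl
difference-injectiveʳ false {true}  {true}  _ = refl
difference-injectiveʳ true  {false} {false} _ = refl
difference-injectiveʳ true  {true}  {true}  _ = refl

difference-≢ˡ⇒≡ : ∀ {a b c d} → difference a b ≡ difference c d → a ≢ c → a ≡ b
difference-≢ˡ⇒≡ {false} {false} _ _ = refl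
difference-≢ˡ⇒≡ {true}  {true}  _ _ = refl
difference-≢ˡ⇒≡ {false} {true}  {false} _ a≢c = ⊥-elim (a≢c refl)
difference-≢ˡ⇒≡ {false} {true}  {true}  {false} ()
difference-≢ˡ⇒≡ {false} {true}  {true}  {true}  ()
difference-≢ˡ⇒≡ {true}  {false} {true}  _ a≢c = ⊥-elim (a≢c refl)
difference-≢ˡ⇒≡ {true}  {false} {false} {false} ()
difference-≢ˡ⇒≡ {true}  {false} {false} {true}  ()

vtm : ℕ → ℕ
vtm n = difference (thueMorse n) (thueMorse (suc n))

vtm<3 : ∀ n → vtm n < 3
vtm<3 n = difference<3 (t n) (t (suc n))

vtm-square⇒thueMorse-repeats : ∀ i L → 1 ≤ L → (∀ j → j < L → vtm (i + j) ≡ vtm (i + L + j)) → t i ≡ t (i + L)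
vtm-square⇒thueMorse-repeats i L 1≤L sq with t i ≟ᵇ t (i + L)
... | yes eq = eq
... | no neq = ⊥-elim (mismatch (ti≡ti+1 neq) (ti+L≡ti+L+1 neq) neq)
  where
    vtm-at : ∀ j → j < L → vtm (j + i) ≡ vtm (j + (i + L))
    vtm-at j j<L = subst₂ (λ a b → vtm a ≡ vtm b) (+-comm i j) (+-comm (i + L) j) (sq j j<L)
    ti≡ti+1 : t i ≢ t (i + L) → t i ≡ t (suc i)
    ti≡ti+1 neq = difference-≢ˡ⇒≡ (vtm-at 0 1≤L) neq
    ti+L≡ti+L+1 : t i ≢ t (i + L) → t (i + L) ≡ t (suc (i + L))
    ti+L≡ti+L+1 neq = difference-≢ˡ⇒≡ (sym (vtm-at 0 1≤L)) (λ e → neq (sym e))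
    mismatch : t i ≡ t (suc i) → t (i + L) ≡ t (suc (i + L)) → t i ≢ t (i + L) → ⊥
    mismatch e₁ e₂ neq with 2 ≤? L
    ... | no  L≱2 = neq (trans e₁ (cong t (sym (trans (cong (i +_) L≡1) (+-comm i 1)))))
      where L≡1 = ≤-antisym (≤-pred (≰⇒> L≱2)) 1≤L
    ... | yes 2≤L = thueMorse-no-three-equal i e₁
                      (difference-≢ˡ⇒≡ (vtm-at 1 2≤L) λ e → neq (trans e₁ (trans e (sym e₂))))

vtm-squareFree : SquareFree vtm
vtm-squareFree i L 1≤L sq = thueMorse-overlapFree L 1≤L i periodic
  where
    eq = vtm-square⇒thueMorse-repeats i L 1≤L sq
    periodic : Overlap i L
    periodic zero    _   = subst₂ (λ a b → t a ≡ t b) (sym (+-identityʳ i)) (cong (_+ L) (sym (+-identityʳ i))) eq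
    periodic (suc j) j<L = subst₂ (λ a b → t a ≡ t b) (sym (+-suc i j)) (cong (_+ L) (sym (+-suc i j)))
      (difference-injectiveʳ (t (i + j)) (begin
        vtm (i + j)                                    ≡⟨ sq j j<L ⟩
        vtm (i + L + j)                                ≡⟨ cong vtm (xy∙z≈xz∙y i L j) ⟩
        difference (t (i + j + L)) (t (suc (i + j + L))) ≡⟨ cong (λ b → difference b (t (suc (i + j + L))))
            (sym (periodic j (<⇒≤ j<L))) ⟩
        difference (t (i + j)) (t (suc (i + j + L)))     ∎))
      where open ≡-Reasoning

-- Arithmetic and walks with bounded steps

quotRem-unique : ∀ n a b u v → u < n → v < n → n * a + u ≡ n * b + v → a ≡ b × u ≡ v
quotRem-unique n zero zero u v _ _ e rewrite *-zeroʳ n = refl , e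
quotRem-unique n zero (suc b) u v u<n _ e rewrite *-zeroʳ n | *-suc n b =
  ⊥-elim (<⇒≱ u<n (subst (n ≤_) (sym e) (≤-trans (m≤m+n n (n * b)) (m≤m+n (n + n * b) v))))
quotRem-unique n (suc a) zero u v _ v<n e rewrite *-zeroʳ n | *-suc n a =
  ⊥-elim (<⇒≱ v<n (subst (n ≤_) e (≤-trans (m≤m+n n (n * a)) (m≤m+n (n + n * a) u))))
quotRem-unique n (suc a) (suc b) u v u<n v<n e rewrite *-suc n a | *-suc n b
  with quotRem-unique n a b u v u<n v<n
      (+-cancelˡ-≡ n (n * a + u) (n * b + v)
      (trans (sym (+-assoc n (n * a) u)) (trans e (+-assoc n (n * b) v))))
... | refl , q = refl , q

double-injective : ∀ {a b} → a + a ≡ b + b → a ≡ b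
double-injective {a} {b} e with <-cmp a b
... | tri< lt _ _ = ⊥-elim (<⇒≢ (+-mono-< lt lt) e)
... | tri≈ _ q _ = q
... | tri> _ _ gt = ⊥-elim (<⇒≢ (+-mono-< gt gt) (sym e))

2*r≡r+r : ∀ r → 2 * r ≡ r + r
2*r≡r+r r = cong (r +_) (+-identityʳ r)

module _ (k : ℕ) where

  descent-hits-window : ∀ (z : ℕ → ℕ) j₀ n c →
    (∀ j → j₀ ≤ j → j < j₀ + n → z (suc j) < z j × z j ≤ z (suc j) + k) →
    c ≤ z j₀ → z (j₀ + n) < c + k → Σ[ j ∈ ℕ ] (j₀ ≤ j × j ≤ j₀ + n × c ≤ z j × z j < c + k)
  descent-hits-window z j₀ zero c _ c≤start end<c+k =
    j₀ , ≤-refl , m≤m+n j₀ 0 , c≤start , subst (λ q → z q < c + k) (+-identityʳ j₀) end<c+k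
  descent-hits-window z j₀ (suc n) c steps c≤start end<c+k with z j₀ <? c + k
  ... | yes start<c+k = j₀ , ≤-refl , m≤m+n j₀ (suc n) , c≤start , start<c+k
  ... | no  start≮c+k
    with descent-hits-window z (suc j₀) n c steps′ c≤next (subst (λ q → z q < c + k) (+-suc j₀ n) end<c+k)
    where
      c≤next : c ≤ z (suc j₀)
      c≤next = +-cancelʳ-≤ k _ _
          (≤-trans (≮⇒≥ start≮c+k)
          (proj₂ (steps j₀ ≤-refl (subst (j₀ <_) (sym (+-suc j₀ n)) (s≤s (m≤m+n j₀ n))))))
      steps′ : ∀ j → suc j₀ ≤ j → j < suc j₀ + n → z (suc j) < z j × z j ≤ z (suc j) + k
      steps′ j j₀<j j<end = steps j (≤-trans (n≤1+n j₀) j₀<j) (subst (j <_) (sym (+-suc j₀ n)) j<end)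
  ... | j , j₀<j , j≤end , c≤zj , zj<c+k = j , ≤-trans (n≤1+n j₀) j₀<j , subst (j ≤_) (sym (+-suc j₀ n)) j≤end ,
      c≤zj , zj<c+k

  walks-cross : ∀ (a b : ℕ → ℕ) j₀ n →
    (∀ j → j₀ ≤ j → j < j₀ + n → Σ[ s ∈ ℕ ] (s ≤ k × a (suc j) + s ≡ a j × b j + s ≡ b (suc j))) →
    b j₀ < a j₀ → a (j₀ + n) ≤ b (j₀ + n) → Σ[ j ∈ ℕ ] (j₀ ≤ j × j ≤ j₀ + n × b j < a j × a j ≤ b j + (k + k))
  walks-cross a b j₀ zero _ b<a a≤b = ⊥-elim (<⇒≱ b<a (subst (λ q → a q ≤ b q) (+-identityʳ j₀) a≤b))
  walks-cross a b j₀ (suc n) steps b<a a≤b with b (suc j₀) <? a (suc j₀)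
  ... | yes b<a′ with walks-cross a b (suc j₀) n
        (λ j j₀<j j<end → steps j (≤-trans (n≤1+n _) j₀<j) (subst (j <_) (sym (+-suc j₀ n)) j<end)) b<a′
        (subst (λ q → a q ≤ b q) (+-suc j₀ n) a≤b)
  ...   | j , j₀<j , j≤end , lt , le = j , ≤-trans (n≤1+n _) j₀<j , subst (j ≤_) (sym (+-suc j₀ n)) j≤end , lt , le
  walks-cross a b j₀ (suc n) steps b<a a≤b | no b≮a′
    with steps j₀ ≤-refl (subst (j₀ <_) (sym (+-suc j₀ n)) (s≤s (m≤m+n j₀ n)))
  ... | s , s≤k , down , up = j₀ , ≤-refl , m≤m+n j₀ (suc n) , b<a , (begin
    a j₀            ≡⟨ down ⟨
    a (suc j₀) + s  ≤⟨ +-monoˡ-≤ s (≮⇒≥ b≮a′) ⟩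
    b (suc j₀) + s  ≡⟨ cong (_+ s) up ⟨
    b j₀ + s + s    ≡⟨ +-assoc (b j₀) s s ⟩
    b j₀ + (s + s)  ≤⟨ +-monoʳ-≤ (b j₀) (+-mono-≤ s≤k s≤k) ⟩
    b j₀ + (k + k)  ∎)
    where open ≤-Reasoning

-- The k-special sequence

module Construction (k : ℕ) (1≤k : 1 ≤ k) (w : ℕ → ℕ) (w<3 : ∀ n → w n < 3) (w-squareFree : SquareFree w) where

  w-adjacent-distinct : ∀ n → w n ≢ w (suc n)
  w-adjacent-distinct n e = w-squareFree n 1 ≤-refl square
    where
      square : ∀ j → j < 1 → w (n + j) ≡ w (n + 1 + j)
      square zero _ = subst₂ (λ a b → w a ≡ w b) (sym (+-identityʳ n))
          (sym (trans (+-identityʳ (n + 1)) (+-comm n 1))) e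
      square (suc j) (s≤s ())

  Q : ℕ
  Q = suc (k + k)

  -- Positions are cut into blocks of length Q.  Block t rises through the heights 0, 1, …, k
  -- and falls back through k, …, 1; the rising half reads letter w (2t), the falling half w (2t + 1).
  data Place (x : ℕ) : Set where
    rising  : (t ρ : ℕ) → ρ ≤ k → x ≡ Q * t + ρ → Place x
    falling : (t ρ : ℕ) → 1 ≤ ρ → ρ ≤ k → x + ρ ≡ Q * suc t → Place x

  place : (x : ℕ) → Place x
  place zero = rising 0 0 z≤n (sym (trans (+-identityʳ (Q * 0)) (*-zeroʳ Q)))
  place (suc x) with place x
  ... | rising t ρ ρ≤k e with ρ <? k
  ...   | yes ρ<k = rising t (suc ρ) ρ<k (trans (cong suc e) (sym (+-suc (Q * t) ρ)))
  ...   | no  ρ≮k = falling t k 1≤k ≤-refl (begin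
          suc x + k               ≡⟨ cong (λ z → suc z + k) e ⟩
          suc (Q * t + ρ) + k     ≡⟨ cong (λ z → suc (Q * t + z) + k) (≤-antisym ρ≤k (≮⇒≥ ρ≮k)) ⟩
          suc (Q * t + k) + k     ≡⟨ top t ⟩
          Q * suc t               ∎)
    where open ≡-Reasoning
          top : ∀ t → suc (Q * t + k) + k ≡ Q * suc t
          top t = trans (cong suc (+-assoc (Q * t) k k))
              (trans (sym (+-suc (Q * t) (k + k))) (trans (+-comm (Q * t) Q) (sym (*-suc Q t))))
  place (suc x) | falling t 1 _ _ e = rising (suc t) 0 z≤n (trans (+-comm 1 x) (trans e (sym (+-identityʳ _))))
  place (suc x) | falling t (suc (suc ρ)) _ ρ≤k e =
    falling t (suc ρ) (s≤s z≤n) (≤-trans (n≤1+n _) ρ≤k) (trans (sym (+-suc x (suc ρ))) e)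

  height : ∀ {x} → Place x → ℕ
  height (rising  _ ρ _ _)   = ρ
  height (falling _ ρ _ _ _) = ρ

  height≤k : ∀ {x} (d : Place x) → height d ≤ k
  height≤k (rising  _ _ ρ≤k _)   = ρ≤k
  height≤k (falling _ _ _ ρ≤k _) = ρ≤k

  halfBlock : ∀ {x} → Place x → ℕ
  halfBlock (rising  t _ _ _)   = t + t
  halfBlock (falling t _ _ _ _) = suc (t + t)

  symbolOf : ℕ → ℕ → ℕ
  symbolOf zero    _ = 0
  symbolOf (suc p) a = suc (p + k * a)

  symbolAt : ∀ {x} → Place x → ℕ
  symbolAt d = symbolOf (height d) (w (halfBlock d))

  symbol : ℕ → ℕ
  symbol x = symbolAt (place x)

  symbolOf≤3k : ∀ {ρ a} → ρ ≤ k → a < 3 → symbolOf ρ a ≤ 3 * k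
  symbolOf≤3k {zero}          _   _   = z≤n
  symbolOf≤3k {suc p} {a} ρ≤k a<3 = begin
    suc p + k * a   ≤⟨ +-mono-≤ ρ≤k (*-monoʳ-≤ k (≤-pred a<3)) ⟩
    k + k * 2       ≡⟨ k+2k k ⟩
    3 * k           ∎
    where open ≤-Reasoning
          k+2k : ∀ k → k + k * 2 ≡ 3 * k
          k+2k = solve-∀

  symbol≤3k : ∀ x → symbol x ≤ 3 * k
  symbol≤3k x = symbolOf≤3k (height≤k (place x)) (w<3 (halfBlock (place x)))

  symbolOf-injective : ∀ {ρ ρ′ a a′} → ρ ≤ k → ρ′ ≤ k → symbolOf ρ a ≡ symbolOf ρ′ a′ → ρ ≡ ρ′ × (1 ≤ ρ → a ≡ a′)
  symbolOf-injective {zero}  {zero}   _ _ _  = refl , λ ()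
  symbolOf-injective {zero}  {suc _}  _ _ ()
  symbolOf-injective {suc _} {zero}   _ _ ()
  symbolOf-injective {suc p} {suc p′} {a} {a′} ρ≤k ρ′≤k eq with
    quotRem-unique k a a′ p p′ ρ≤k ρ′≤k (trans (+-comm (k * a) p) (trans (suc-injective eq) (+-comm p′ (k * a′))))
  ... | refl , refl = refl , λ _ → refl

  ≡symbol⇒≡height : ∀ {x y} (d : Place x) (e : Place y) → symbolAt d ≡ symbolAt e → height d ≡ height e
  ≡symbol⇒≡height d e eq = proj₁ (symbolOf-injective (height≤k d) (height≤k e) eq)

  ≡symbol⇒≡letter : ∀ {x y} (d : Place x) (e : Place y) → symbolAt d ≡ symbolAt e → 1 ≤ height d →
      w (halfBlock d) ≡ w (halfBlock e)
  ≡symbol⇒≡letter d e eq = proj₂ (symbolOf-injective (height≤k d) (height≤k e) eq)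

  ≡symbol⇒≡letterʳ : ∀ {x y} (d : Place x) (e : Place y) → symbolAt d ≡ symbolAt e → 1 ≤ height e →
      w (halfBlock d) ≡ w (halfBlock e)
  ≡symbol⇒≡letterʳ d e eq 1≤h = ≡symbol⇒≡letter d e eq (subst (1 ≤_) (sym (≡symbol⇒≡height d e eq)) 1≤h)

  +<Q : ∀ {a b} → a ≤ k → b ≤ k → a + b < Q
  +<Q a≤ b≤ = s≤s (+-mono-≤ a≤ b≤)

  ≤k⇒<Q : ∀ {a} → a ≤ k → a < Q
  ≤k⇒<Q a≤ = s≤s (≤-trans a≤ (m≤m+n k k))

  Q*-suc : ∀ a → Q * suc a ≡ Q * a + Q
  Q*-suc a = trans (*-suc Q a) (+-comm Q (Q * a))

  step-rr : ∀ {x x′ s t ρ t′ ρ′} → ρ ≤ k → ρ′ ≤ k → s ≤ k →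
            x ≡ Q * t + ρ → x′ ≡ Q * t′ + ρ′ → x′ + s ≡ x → t′ ≡ t × ρ′ + s ≡ ρ
  step-rr {t′ = t′} {ρ′} ρ≤k ρ′≤k s≤k ex ex′ m = quotRem-unique Q _ _ _ _ (+<Q ρ′≤k s≤k) (≤k⇒<Q ρ≤k)
    (trans (sym (+-assoc (Q * t′) ρ′ _)) (trans (cong (_+ _) (sym ex′)) (trans m ex)))

  step-fr : ∀ {x x′ s t ρ t′ ρ′} → ρ ≤ k → ρ′ ≤ k → s ≤ k →
            x ≡ Q * t + ρ → x′ + ρ′ ≡ Q * suc t′ → x′ + s ≡ x → t ≡ suc t′ × ρ + ρ′ ≡ s
  step-fr {x} {x′} {s} {t} {ρ} {t′} {ρ′} ρ≤k ρ′≤k s≤k ex ex′ m =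
    quotRem-unique Q t (suc t′) (ρ + ρ′) s (+<Q ρ≤k ρ′≤k) (≤k⇒<Q s≤k) (begin
      Q * t + (ρ + ρ′) ≡⟨ +-assoc (Q * t) ρ ρ′ ⟨
      Q * t + ρ + ρ′   ≡⟨ cong (_+ ρ′) (trans (sym ex) (sym m)) ⟩
      x′ + s + ρ′      ≡⟨ xy∙z≈xz∙y x′ s ρ′ ⟩
      x′ + ρ′ + s      ≡⟨ cong (_+ s) ex′ ⟩
      Q * suc t′ + s   ∎)
    where open ≡-Reasoning

  step-ff : ∀ {x x′ s t ρ t′ ρ′} → ρ ≤ k → ρ′ ≤ k → s ≤ k →
            x + ρ ≡ Q * suc t → x′ + ρ′ ≡ Q * suc t′ → x′ + s ≡ x → t′ ≡ t × ρ′ ≡ ρ + s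
  step-ff {x} {x′} {s} {t} {ρ} {t′} {ρ′} ρ≤k ρ′≤k s≤k ex ex′ m
    with quotRem-unique Q (suc t′) (suc t) (ρ + s) ρ′ (+<Q ρ≤k s≤k) (≤k⇒<Q ρ′≤k) (begin
      Q * suc t′ + (ρ + s)  ≡⟨ cong (_+ (ρ + s)) (sym ex′) ⟩
      x′ + ρ′ + (ρ + s)     ≡⟨ rearrange x′ ρ′ ρ s ⟩
      x′ + s + ρ + ρ′       ≡⟨ cong (λ z → z + ρ + ρ′) m ⟩
      x + ρ + ρ′            ≡⟨ cong (_+ ρ′) ex ⟩
      Q * suc t + ρ′        ∎)
    where open ≡-Reasoning
          rearrange : ∀ a b c d → a + b + (c + d) ≡ a + d + c + b
          rearrange = solve-∀
  ... | refl , e = refl , sym e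

  step-rf : ∀ {x x′ s t ρ t′ ρ′} → 1 ≤ ρ → ρ ≤ k → ρ′ ≤ k → s ≤ k →
            x + ρ ≡ Q * suc t → x′ ≡ Q * t′ + ρ′ → x′ + s ≡ x → t′ ≡ t × ρ + ρ′ + s ≡ Q
  step-rf {x} {x′} {s} {t} {ρ} {t′} {ρ′} 1≤ρ ρ≤k ρ′≤k s≤k ex ex′ m
    with quotRem-unique Q t′ t (ρ′ + s) (Q ∸ ρ) (+<Q ρ′≤k s≤k) (∸-monoʳ-< 1≤ρ ρ≤Q) (+-cancelʳ-≡ ρ _ _ (begin
      Q * t′ + (ρ′ + s) + ρ   ≡⟨ cong (_+ ρ) (trans (sym (+-assoc (Q * t′) ρ′ s)) (trans (cong (_+ s) (sym ex′)) m)) ⟩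
      x + ρ                   ≡⟨ ex ⟩
      Q * suc t               ≡⟨ trans (*-suc Q t) (+-comm Q (Q * t)) ⟩
      Q * t + Q               ≡⟨ cong (Q * t +_) (m∸n+n≡m ρ≤Q) ⟨
      Q * t + (Q ∸ ρ + ρ)     ≡⟨ +-assoc (Q * t) (Q ∸ ρ) ρ ⟨
      Q * t + (Q ∸ ρ) + ρ     ∎))
    where open ≡-Reasoning
          ρ≤Q = <⇒≤ (≤k⇒<Q ρ≤k)
  ... | refl , e = refl , trans (+-assoc ρ ρ′ s) (trans (cong (ρ +_) e) (m+[n∸m]≡n ρ≤Q))
    where ρ≤Q = <⇒≤ (≤k⇒<Q ρ≤k)

  Step : ∀ {x x′} → Place x → Place x′ → ℕ → Set
  Step (rising t ρ _ _)    (rising t′ ρ′ _ _)    s = t′ ≡ t × ρ′ + s ≡ ρ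
  Step (rising t ρ _ _)    (falling t′ ρ′ _ _ _) s = t ≡ suc t′ × ρ + ρ′ ≡ s
  Step (falling t ρ _ _ _) (falling t′ ρ′ _ _ _) s = t′ ≡ t × ρ′ ≡ ρ + s
  Step (falling t ρ _ _ _) (rising t′ ρ′ _ _)    s = t′ ≡ t × ρ + ρ′ + s ≡ Q

  step : ∀ {x x′ s} (d : Place x) (d′ : Place x′) → x′ + s ≡ x → s ≤ k → Step d d′ s
  step (rising  _ _ ρ≤k e)     (rising  _ _ ρ′≤k e′)   m s≤k = step-rr ρ≤k ρ′≤k s≤k e e′ m
  step (rising  _ _ ρ≤k e)     (falling _ _ _ ρ′≤k e′) m s≤k = step-fr ρ≤k ρ′≤k s≤k e e′ m
  step (falling _ _ _ ρ≤k e)   (falling _ _ _ ρ′≤k e′) m s≤k = step-ff ρ≤k ρ′≤k s≤k e e′ m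
  step (falling _ _ 1≤ρ ρ≤k e) (rising  _ _ ρ′≤k e′)   m s≤k = step-rf 1≤ρ ρ≤k ρ′≤k s≤k e e′ m

  SameSlope : ∀ {x y} → Place x → Place y → Set
  SameSlope (rising _ _ _ _) (rising _ _ _ _) = ⊤
  SameSlope (falling _ _ _ _ _) (falling _ _ _ _ _) = ⊤
  SameSlope _ _ = ⊥

  Mirrored : ∀ {x y} → Place x → Place y → Set
  Mirrored (rising _ ρ _ _) (rising _ _ _ _) = ρ ≡ 0
  Mirrored (rising _ _ _ _) (falling _ _ _ _ _) = ⊤
  Mirrored (falling _ _ _ _ _) (rising _ _ _ _) = ⊤
  Mirrored (falling _ _ _ _ _) (falling _ _ _ _ _) = ⊥

  w-rising≢falling : ∀ t → w (t + t) ≡ w (suc (t + t)) → ⊥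
  w-rising≢falling t e = w-adjacent-distinct (t + t) e

  w-falling≢rising : ∀ t → w (suc (t + t)) ≡ w (suc t + suc t) → ⊥
  w-falling≢rising t e = w-adjacent-distinct (suc (t + t)) (trans e (cong w (cong suc (+-suc t t))))

  +≢Q : ∀ {a b} → a ≤ k → b ≤ k → a + b ≡ Q → ⊥
  +≢Q a≤ b≤ e = <⇒≢ (+<Q a≤ b≤) e

  same-difference : ∀ {a b a′ b′ s s′} → a ≡ a′ → b ≡ b′ → a + s ≡ b → a′ + s′ ≡ b′ → s ≡ s′
  same-difference {a} refl refl e e′ = +-cancelˡ-≡ a _ _ (trans e (sym e′))
  same-sum : ∀ {a b a′ b′ s s′} → a ≡ a′ → b ≡ b′ → a + b ≡ s → a′ + b′ ≡ s′ → s ≡ s′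
  same-sum refl refl e e′ = trans (sym e) e′
  same-complement : ∀ {a b a′ b′ s s′} → a ≡ a′ → b ≡ b′ → a + b + s ≡ Q → a′ + b′ + s′ ≡ Q → s ≡ s′
  same-complement {a} {b} refl refl e e′ = +-cancelˡ-≡ (a + b) _ _ (trans e (sym e′))

  positive-sum : ∀ {a s b} → 1 ≤ s → a + s ≡ b → 1 ≤ b
  positive-sum {a} {s} l refl = ≤-trans l (m≤n+m s a)

  opposite-differences : ∀ {a b a′ b′ s s′} → 1 ≤ s′ → a ≡ a′ → b ≡ b′ → b + s ≡ a → b′ ≡ a′ + s′ → ⊥
  opposite-differences {a} {b} {s = s} {s′} l refl refl e e′ = <⇒≱ (m<m+n a l)
      (≤-trans (≤-reflexive (sym e′)) (≤-trans (m≤m+n b s) (≤-reflexive e)))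

  sum-vs-complement : ∀ {a b a′ b′ s s′} → a ≡ a′ → b ≡ b′ → a + b ≡ s → a′ + b′ + s′ ≡ Q → s ≤ k → s′ ≤ k → ⊥
  sum-vs-complement refl refl e e′ l l′ = +≢Q l l′ (trans (cong (_+ _) (sym e)) e′)

  StepUp : ℕ → ℕ → Set
  StepUp x y = Σ[ s ∈ ℕ ] (1 ≤ s × s ≤ k × x + s ≡ y)

  stepUp : ∀ {p q} → q < p → p ≤ q + k → StepUp q p
  stepUp {p} {q} lt le = p ∸ q , m<n⇒0<n∸m lt , ≤-trans (∸-monoˡ-≤ q le) (≤-reflexive (m+n∸m≡n q k)) , m+[n∸m]≡n
      (<⇒≤ lt)

  -- In every configuration other than the matching ones, the equal heights and letters given by equal symbols
  -- contradict w n ≢ w (suc n) or the bound on step lengths.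
  parallel-steps : ∀ {x y x′ y′} (st₁ : StepUp x′ x) (st₂ : StepUp y′ y)
                   (dx : Place x) (dy : Place y) (dx′ : Place x′) (dy′ : Place y′) →
                   symbolAt dx ≡ symbolAt dy → symbolAt dx′ ≡ symbolAt dy′ →
                   proj₁ st₁ ≡ proj₁ st₂ × SameSlope dx dy × SameSlope dx′ dy′
  parallel-steps (_ , 1≤s₁ , s₁≤k , e₁) (_ , 1≤s₂ , s₂≤k , e₂) dx@(rising _ _ _ _) dy@(rising _ _ _ _)
      dx′@(rising _ _ _ _) dy′@(rising _ _ _ _) c c′ =
    same-difference (≡symbol⇒≡height dx′ dy′ c′) (≡symbol⇒≡height dx dy c) (proj₂ (step dx dx′ e₁ s₁≤k))
        (proj₂ (step dy dy′ e₂ s₂≤k)) , tt , tt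
  parallel-steps (_ , 1≤s₁ , s₁≤k , e₁) (_ , 1≤s₂ , s₂≤k , e₂) dx@(rising _ _ _ _) dy@(rising _ _ _ _)
      dx′@(falling _ _ _ _ _) dy′@(falling _ _ _ _ _) c c′ =
    same-sum (≡symbol⇒≡height dx dy c) (≡symbol⇒≡height dx′ dy′ c′) (proj₂ (step dx dx′ e₁ s₁≤k))
        (proj₂ (step dy dy′ e₂ s₂≤k)) , tt , tt
  parallel-steps (_ , 1≤s₁ , s₁≤k , e₁) (_ , 1≤s₂ , s₂≤k , e₂) dx@(falling _ _ _ _ _) dy@(falling _ _ _ _ _)
      dx′@(falling _ _ _ _ _) dy′@(falling _ _ _ _ _) c c′ =
    same-difference (≡symbol⇒≡height dx dy c) (≡symbol⇒≡height dx′ dy′ c′) (sym (proj₂ (step dx dx′ e₁ s₁≤k)))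
        (sym (proj₂ (step dy dy′ e₂ s₂≤k))) , tt , tt
  parallel-steps (_ , 1≤s₁ , s₁≤k , e₁) (_ , 1≤s₂ , s₂≤k , e₂) dx@(falling _ _ _ _ _) dy@(falling _ _ _ _ _)
      dx′@(rising _ _ _ _) dy′@(rising _ _ _ _) c c′ =
    same-complement (≡symbol⇒≡height dx dy c) (≡symbol⇒≡height dx′ dy′ c′) (proj₂ (step dx dx′ e₁ s₁≤k))
        (proj₂ (step dy dy′ e₂ s₂≤k)) , tt , tt
  parallel-steps (_ , 1≤s₁ , s₁≤k , e₁) (_ , 1≤s₂ , s₂≤k , e₂) dx@(rising _ _ _ _) dy@(falling _ _ _ _ _)
      dx′@(rising _ _ _ _) dy′@(falling _ _ _ _ _) c c′ =
    ⊥-elim (opposite-differences 1≤s₂ (≡symbol⇒≡height dx dy c) (≡symbol⇒≡height dx′ dy′ c′)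
        (proj₂ (step dx dx′ e₁ s₁≤k)) (proj₂ (step dy dy′ e₂ s₂≤k)))
  parallel-steps (_ , 1≤s₁ , s₁≤k , e₁) (_ , 1≤s₂ , s₂≤k , e₂) dx@(falling _ _ _ _ _) dy@(rising _ _ _ _)
      dx′@(falling _ _ _ _ _) dy′@(rising _ _ _ _) c c′ =
    ⊥-elim (opposite-differences 1≤s₁ (sym (≡symbol⇒≡height dx dy c)) (sym (≡symbol⇒≡height dx′ dy′ c′))
        (proj₂ (step dy dy′ e₂ s₂≤k)) (proj₂ (step dx dx′ e₁ s₁≤k)))
  parallel-steps (_ , 1≤s₁ , s₁≤k , e₁) (_ , 1≤s₂ , s₂≤k , e₂) dx@(rising _ _ _ _) dy@(falling _ _ _ _ _)
      dx′@(falling _ _ _ _ _) dy′@(rising _ _ _ _) c c′ =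
    ⊥-elim (sum-vs-complement (≡symbol⇒≡height dx dy c) (≡symbol⇒≡height dx′ dy′ c′)
        (proj₂ (step dx dx′ e₁ s₁≤k)) (proj₂ (step dy dy′ e₂ s₂≤k)) s₁≤k s₂≤k)
  parallel-steps (_ , 1≤s₁ , s₁≤k , e₁) (_ , 1≤s₂ , s₂≤k , e₂) dx@(falling _ _ _ _ _) dy@(rising _ _ _ _)
      dx′@(rising _ _ _ _) dy′@(falling _ _ _ _ _) c c′ =
    ⊥-elim (sum-vs-complement (sym (≡symbol⇒≡height dx dy c)) (sym (≡symbol⇒≡height dx′ dy′ c′))
        (proj₂ (step dy dy′ e₂ s₂≤k)) (proj₂ (step dx dx′ e₁ s₁≤k)) s₂≤k s₁≤k)
  parallel-steps (_ , 1≤s₁ , s₁≤k , e₁) (_ , 1≤s₂ , s₂≤k , e₂) dx@(rising _ _ _ _) dy@(rising _ _ _ _)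
      dx′@(rising _ _ _ _) dy′@(falling ty′ _ 1y′ _ _) c c′
    with step dx dx′ e₁ s₁≤k | step dy dy′ e₂ s₂≤k
  ... | refl , e1 | refl , e2 = ⊥-elim
      (w-falling≢rising ty′
      (trans (sym (≡symbol⇒≡letterʳ dx′ dy′ c′ 1y′))
      (≡symbol⇒≡letter dx dy c (positive-sum 1≤s₁ e1))))
  parallel-steps (_ , 1≤s₁ , s₁≤k , e₁) (_ , 1≤s₂ , s₂≤k , e₂) dx@(rising _ _ _ _) dy@(rising _ _ _ _)
      dx′@(falling tx′ _ 1x′ _ _) dy′@(rising _ _ _ _) c c′
    with step dx dx′ e₁ s₁≤k | step dy dy′ e₂ s₂≤k
  ... | refl , e1 | refl , e2 = ⊥-elim
      (w-falling≢rising tx′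
      (trans (≡symbol⇒≡letter dx′ dy′ c′ 1x′)
      (sym (≡symbol⇒≡letterʳ dx dy c (positive-sum 1≤s₂ e2)))))
  parallel-steps (_ , 1≤s₁ , s₁≤k , e₁) (_ , 1≤s₂ , s₂≤k , e₂) dx@(rising _ _ _ _) dy@(falling _ ρy _ ly _)
      dx′@(rising _ zero _ _) dy′@(rising _ _ _ _) c c′
    with step dy dy′ e₂ s₂≤k | ≡symbol⇒≡height dx′ dy′ c′
  ... | refl , e2 | refl = ⊥-elim (+≢Q ly s₂≤k (trans (cong (_+ _) (sym (+-identityʳ ρy))) e2))
  parallel-steps (_ , 1≤s₁ , s₁≤k , e₁) (_ , 1≤s₂ , s₂≤k , e₂) dx@(rising _ _ _ _) dy@(falling ty _ 1y _ _)
      dx′@(rising _ (suc _) _ _) dy′@(rising _ _ _ _) c c′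
    with step dx dx′ e₁ s₁≤k | step dy dy′ e₂ s₂≤k
  ... | refl , e1 | refl , e2 = ⊥-elim
      (w-rising≢falling ty (trans (sym (≡symbol⇒≡letter dx′ dy′ c′ (s≤s z≤n)))
      (≡symbol⇒≡letterʳ dx dy c 1y)))
  parallel-steps (_ , 1≤s₁ , s₁≤k , e₁) (_ , 1≤s₂ , s₂≤k , e₂) dx@(falling _ ρx _ lx _) dy@(rising _ _ _ _)
      dx′@(rising _ zero _ _) dy′@(rising _ _ _ _) c c′
    with step dx dx′ e₁ s₁≤k
  ... | refl , e1 = ⊥-elim (+≢Q lx s₁≤k (trans (cong (_+ _) (sym (+-identityʳ ρx))) e1))
  parallel-steps (_ , 1≤s₁ , s₁≤k , e₁) (_ , 1≤s₂ , s₂≤k , e₂) dx@(falling tx _ 1x _ _) dy@(rising _ _ _ _)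
      dx′@(rising _ (suc _) _ _) dy′@(rising _ _ _ _) c c′
    with step dx dx′ e₁ s₁≤k | step dy dy′ e₂ s₂≤k
  ... | refl , e1 | refl , e2 = ⊥-elim
      (w-rising≢falling tx (trans (≡symbol⇒≡letter dx′ dy′ c′ (s≤s z≤n)) (sym (≡symbol⇒≡letter dx dy c 1x))))
  parallel-steps (_ , 1≤s₁ , s₁≤k , e₁) (_ , 1≤s₂ , s₂≤k , e₂) dx@(rising _ _ _ _) dy@(falling _ _ 1y _ _)
      dx′@(falling tx′ _ 1x′ _ _) dy′@(falling _ _ _ _ _) c c′
    with step dx dx′ e₁ s₁≤k | step dy dy′ e₂ s₂≤k
  ... | refl , e1 | refl , e2 = ⊥-elim
      (w-falling≢rising tx′
      (trans (≡symbol⇒≡letter dx′ dy′ c′ 1x′)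
      (sym (≡symbol⇒≡letterʳ dx dy c 1y))))
  parallel-steps (_ , 1≤s₁ , s₁≤k , e₁) (_ , 1≤s₂ , s₂≤k , e₂) dx@(falling _ _ 1x _ _) dy@(rising _ _ _ _)
      dx′@(falling _ _ _ _ _) dy′@(falling ty′ _ 1y′ _ _) c c′
    with step dx dx′ e₁ s₁≤k | step dy dy′ e₂ s₂≤k
  ... | refl , e1 | refl , e2 = ⊥-elim
      (w-falling≢rising ty′
      (trans (sym (≡symbol⇒≡letterʳ dx′ dy′ c′ 1y′))
      (≡symbol⇒≡letter dx dy c 1x)))
  parallel-steps (_ , 1≤s₁ , s₁≤k , e₁) (_ , 1≤s₂ , s₂≤k , e₂) dx@(falling _ _ 1x _ _)
      dy@(falling ty _ _ _ _) dx′@(falling _ _ 1x′ _ _) dy′@(rising _ _ _ _) c c′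
    with step dx dx′ e₁ s₁≤k | step dy dy′ e₂ s₂≤k
  ... | refl , e1 | refl , e2 = ⊥-elim
      (w-rising≢falling ty (trans (sym (≡symbol⇒≡letter dx′ dy′ c′ 1x′)) (≡symbol⇒≡letter dx dy c 1x)))
  parallel-steps (_ , 1≤s₁ , s₁≤k , e₁) (_ , 1≤s₂ , s₂≤k , e₂) dx@(falling tx _ 1x _ _)
      dy@(falling _ _ _ _ _) dx′@(rising _ _ _ _) dy′@(falling _ _ 1y′ _ _) c c′
    with step dx dx′ e₁ s₁≤k | step dy dy′ e₂ s₂≤k
  ... | refl , e1 | refl , e2 = ⊥-elim
      (w-rising≢falling tx (trans
      (≡symbol⇒≡letterʳ dx′ dy′ c′ 1y′)
      (sym (≡symbol⇒≡letter dx dy c 1x))))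

  antiparallel-steps : ∀ {x y x′ y′} (st₁ : StepUp x′ x) (st₂ : StepUp y y′)
                       (dx : Place x) (dy : Place y) (dx′ : Place x′) (dy′ : Place y′) →
                       symbolAt dx ≡ symbolAt dy → symbolAt dx′ ≡ symbolAt dy′ →
                       proj₁ st₁ ≡ proj₁ st₂ × Mirrored dx dy × Mirrored dx′ dy′
  antiparallel-steps (_ , 1≤s₁ , s₁≤k , e₁) (_ , 1≤s₂ , s₂≤k , e₂) dx@(rising _ _ _ _) dy@(falling _ _ _ _ _)
      dx′@(rising _ _ _ _) dy′@(falling _ _ _ _ _) c c′ =
    same-difference (≡symbol⇒≡height dx′ dy′ c′) (≡symbol⇒≡height dx dy c) (proj₂ (step dx dx′ e₁ s₁≤k))
        (sym (proj₂ (step dy′ dy e₂ s₂≤k))) , tt , tt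
  antiparallel-steps (_ , 1≤s₁ , s₁≤k , e₁) (_ , 1≤s₂ , s₂≤k , e₂) dx@(falling _ _ _ _ _) dy@(rising _ _ _ _)
      dx′@(falling _ _ _ _ _) dy′@(rising _ _ _ _) c c′ =
    same-difference (≡symbol⇒≡height dx dy c) (≡symbol⇒≡height dx′ dy′ c′) (sym (proj₂ (step dx dx′ e₁ s₁≤k)))
        (proj₂ (step dy′ dy e₂ s₂≤k)) , tt , tt
  antiparallel-steps (_ , 1≤s₁ , s₁≤k , e₁) (_ , 1≤s₂ , s₂≤k , e₂) dx@(rising _ _ _ _) dy@(falling _ _ _ _ _)
      dx′@(falling _ _ _ _ _) dy′@(rising _ ρy′ _ _) c c′ =
    same-sum (≡symbol⇒≡height dx dy c) (≡symbol⇒≡height dx′ dy′ c′) (proj₂ (step dx dx′ e₁ s₁≤k))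
        (trans (+-comm _ ρy′) (proj₂ (step dy′ dy e₂ s₂≤k))) , tt , tt
  antiparallel-steps (_ , 1≤s₁ , s₁≤k , e₁) (_ , 1≤s₂ , s₂≤k , e₂) dx@(falling _ _ _ _ _) dy@(rising _ ρy _ _)
      dx′@(rising _ _ _ _) dy′@(falling _ ρy′ _ _ _) c c′ =
    same-complement (≡symbol⇒≡height dx dy c) (≡symbol⇒≡height dx′ dy′ c′) (proj₂ (step dx dx′ e₁ s₁≤k))
        (trans (xy∙z≈yx∙z ρy ρy′ _) (proj₂ (step dy′ dy e₂ s₂≤k))) , tt , tt
  antiparallel-steps (_ , 1≤s₁ , s₁≤k , e₁) (_ , 1≤s₂ , s₂≤k , e₂) dx@(rising _ _ _ _) dy@(falling _ _ _ _ _)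
      dx′@(rising _ zero _ _) dy′@(rising _ _ _ _) c c′
    with step dx dx′ e₁ s₁≤k | step dy′ dy e₂ s₂≤k | ≡symbol⇒≡height dx′ dy′ c′ | ≡symbol⇒≡height dx dy c
  ... | _ , e1 | _ , e2 | refl | refl = trans e1 e2 , tt , refl
  antiparallel-steps (_ , 1≤s₁ , s₁≤k , e₁) (_ , 1≤s₂ , s₂≤k , e₂) dx@(rising _ _ _ _)
      dy@(falling ty _ 1y _ _) dx′@(rising _ (suc _) _ _) dy′@(rising _ _ _ _) c c′
    with step dx dx′ e₁ s₁≤k | step dy′ dy e₂ s₂≤k
  ... | refl , e1 | refl , e2 = ⊥-elim
      (w-falling≢rising ty (trans
      (sym (≡symbol⇒≡letterʳ dx dy c 1y))
      (≡symbol⇒≡letter dx′ dy′ c′ (s≤s z≤n))))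
  antiparallel-steps (_ , 1≤s₁ , s₁≤k , e₁) (_ , 1≤s₂ , s₂≤k , e₂) dx@(rising _ zero _ _) dy@(rising _ _ _ _)
      dx′@(falling _ _ _ _ _) dy′@(rising _ _ _ _) c c′
    with step dx dx′ e₁ s₁≤k | step dy′ dy e₂ s₂≤k | ≡symbol⇒≡height dx′ dy′ c′ | ≡symbol⇒≡height dx dy c
  ... | _ , e1 | _ , e2 | refl | refl = trans (sym e1) (sym e2) , refl , tt
  antiparallel-steps (_ , 1≤s₁ , s₁≤k , e₁) (_ , 1≤s₂ , s₂≤k , e₂) dx@(rising _ (suc _) _ _)
      dy@(rising _ _ _ _) dx′@(falling tx′ _ 1x′ _ _) dy′@(rising _ _ _ _) c c′
    with step dx dx′ e₁ s₁≤k | step dy′ dy e₂ s₂≤k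
  ... | refl , e1 | refl , e2 = ⊥-elim
      (w-falling≢rising tx′ (trans (≡symbol⇒≡letter dx′ dy′ c′ 1x′) (sym (≡symbol⇒≡letter dx dy c (s≤s z≤n)))))
  antiparallel-steps (_ , 1≤s₁ , s₁≤k , e₁) (_ , 1≤s₂ , s₂≤k , e₂) dx@(rising _ _ _ _) dy@(rising _ _ _ _)
      dx′@(rising _ _ _ _) dy′@(rising _ _ _ _) c c′ =
    ⊥-elim (opposite-differences 1≤s₂ (≡symbol⇒≡height dx dy c) (≡symbol⇒≡height dx′ dy′ c′)
        (proj₂ (step dx dx′ e₁ s₁≤k)) (sym (proj₂ (step dy′ dy e₂ s₂≤k))))
  antiparallel-steps (_ , 1≤s₁ , s₁≤k , e₁) (_ , 1≤s₂ , s₂≤k , e₂) dx@(falling _ _ _ _ _) dy@(falling _ _ _ _ _)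
      dx′@(falling _ _ _ _ _) dy′@(falling _ _ _ _ _) c c′ =
    ⊥-elim (opposite-differences 1≤s₁ (sym (≡symbol⇒≡height dx dy c)) (sym (≡symbol⇒≡height dx′ dy′ c′))
        (sym (proj₂ (step dy′ dy e₂ s₂≤k))) (proj₂ (step dx dx′ e₁ s₁≤k)))
  antiparallel-steps (_ , 1≤s₁ , s₁≤k , e₁) (_ , 1≤s₂ , s₂≤k , e₂) dx@(rising _ _ _ _) dy@(rising _ ρy _ _)
      dx′@(falling _ _ _ _ _) dy′@(falling _ ρy′ _ _ _) c c′ =
    ⊥-elim (sum-vs-complement (≡symbol⇒≡height dx dy c) (≡symbol⇒≡height dx′ dy′ c′)
        (proj₂ (step dx dx′ e₁ s₁≤k)) (trans (xy∙z≈yx∙z ρy ρy′ _) (proj₂ (step dy′ dy e₂ s₂≤k))) s₁≤k s₂≤k)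
  antiparallel-steps (_ , 1≤s₁ , s₁≤k , e₁) (_ , 1≤s₂ , s₂≤k , e₂) dx@(falling _ _ _ _ _)
      dy@(falling _ ρy _ _ _) dx′@(rising _ _ _ _) dy′@(rising _ ρy′ _ _) c c′ =
    ⊥-elim (sum-vs-complement (sym (≡symbol⇒≡height dx dy c)) (sym (≡symbol⇒≡height dx′ dy′ c′))
        (trans (+-comm ρy ρy′) (proj₂ (step dy′ dy e₂ s₂≤k))) (proj₂ (step dx dx′ e₁ s₁≤k)) s₂≤k s₁≤k)
  antiparallel-steps (_ , 1≤s₁ , s₁≤k , e₁) (_ , 1≤s₂ , s₂≤k , e₂) dx@(rising _ _ _ _) dy@(rising ty _ _ _)
      dx′@(rising _ _ _ _) dy′@(falling _ _ 1y′ _ _) c c′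
    with step dx dx′ e₁ s₁≤k | step dy′ dy e₂ s₂≤k
  ... | refl , e1 | refl , e2 = ⊥-elim
      (w-rising≢falling ty (trans (sym (≡symbol⇒≡letter dx dy c (positive-sum 1≤s₁ e1)))
      (≡symbol⇒≡letterʳ dx′ dy′ c′ 1y′)))
  antiparallel-steps (_ , 1≤s₁ , s₁≤k , e₁) (_ , 1≤s₂ , s₂≤k , e₂) dx@(falling _ ρx _ lx _)
      dy@(rising _ _ _ _) dx′@(rising _ zero _ _) dy′@(rising _ _ _ _) c c′
    with step dx dx′ e₁ s₁≤k
  ... | refl , e1 = ⊥-elim (+≢Q lx s₁≤k (trans (cong (_+ _) (sym (+-identityʳ ρx))) e1))
  antiparallel-steps (_ , 1≤s₁ , s₁≤k , e₁) (_ , 1≤s₂ , s₂≤k , e₂) dx@(falling tx _ 1x _ _)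
      dy@(rising _ _ _ _) dx′@(rising _ (suc _) _ _) dy′@(rising _ _ _ _) c c′
    with step dx dx′ e₁ s₁≤k | step dy′ dy e₂ s₂≤k
  ... | refl , e1 | refl , e2 = ⊥-elim
      (w-rising≢falling tx (trans (≡symbol⇒≡letter dx′ dy′ c′ (s≤s z≤n)) (sym (≡symbol⇒≡letter dx dy c 1x))))
  antiparallel-steps (_ , 1≤s₁ , s₁≤k , e₁) (_ , 1≤s₂ , s₂≤k , e₂) dx@(rising _ _ _ _)
      dy@(falling _ _ 1y _ _) dx′@(falling tx′ _ 1x′ _ _) dy′@(falling _ _ _ _ _) c c′
    with step dx dx′ e₁ s₁≤k | step dy′ dy e₂ s₂≤k
  ... | refl , e1 | refl , e2 = ⊥-elim
      (w-falling≢rising tx′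
      (trans (≡symbol⇒≡letter dx′ dy′ c′ 1x′)
      (sym (≡symbol⇒≡letterʳ dx dy c 1y))))
  antiparallel-steps (_ , 1≤s₁ , s₁≤k , e₁) (_ , 1≤s₂ , s₂≤k , e₂) dx@(falling _ _ 1x _ _)
      dy@(falling ty _ _ _ _) dx′@(falling _ _ 1x′ _ _) dy′@(rising _ _ _ _) c c′
    with step dx dx′ e₁ s₁≤k | step dy′ dy e₂ s₂≤k
  ... | refl , e1 | refl , e2 = ⊥-elim
      (w-falling≢rising ty (trans (sym (≡symbol⇒≡letter dx dy c 1x)) (≡symbol⇒≡letter dx′ dy′ c′ 1x′)))
  antiparallel-steps (_ , 1≤s₁ , s₁≤k , e₁) (_ , 1≤s₂ , s₂≤k , e₂) dx@(falling tx _ 1x _ _)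
      dy@(falling _ _ _ _ _) dx′@(rising _ _ _ _) dy′@(falling _ _ 1y′ _ _) c c′
    with step dx dx′ e₁ s₁≤k | step dy′ dy e₂ s₂≤k
  ... | refl , e1 | refl , e2 = ⊥-elim
      (w-rising≢falling tx (trans
      (≡symbol⇒≡letterʳ dx′ dy′ c′ 1y′)
      (sym (≡symbol⇒≡letter dx dy c 1x))))
  antiparallel-steps (_ , 1≤s₁ , s₁≤k , e₁) (_ , 1≤s₂ , s₂≤k , e₂) dx@(falling _ _ 1x _ _)
      dy@(rising ty _ _ _) dx′@(falling _ _ 1x′ _ _) dy′@(falling _ _ _ _ _) c c′
    with step dx dx′ e₁ s₁≤k | step dy′ dy e₂ s₂≤k
  ... | refl , e1 | refl , e2 = ⊥-elim
      (w-rising≢falling ty (trans (sym (≡symbol⇒≡letter dx dy c 1x)) (≡symbol⇒≡letter dx′ dy′ c′ 1x′)))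

  Q*-≤-cancel : ∀ {a b c} → Q * a ≤ Q * b + c → c < Q → a ≤ b
  Q*-≤-cancel {a} {b} {c} le c<Q with a ≤? b
  ... | yes p = p
  ... | no np = ⊥-elim (<⇒≱ (+-monoʳ-< (Q * b) c<Q)
      (≤-trans (≤-reflexive (sym (Q*-suc b))) (≤-trans (*-monoʳ-≤ Q (≰⇒> np)) le)))

  2k<Q : k + k < Q
  2k<Q = ≤-refl

  -- Two places of equal height at distance at most 2k lie in adjacent half-blocks.
  near-symbols-distinct : ∀ {x y} → y < x → x ≤ y + (k + k) → (dx : Place x) (dy : Place y) →
      symbolAt dx ≡ symbolAt dy → ⊥
  near-symbols-distinct {x} {y} yx xy dx@(rising tx ρ _ ex) dy@(rising ty _ _ ey) c with ≡symbol⇒≡height dx dy c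
  ... | refl = <⇒≱ yx (subst₂ _≤_ (sym ex) (sym ey) (+-monoˡ-≤ ρ (*-monoʳ-≤ Q tx≤ty)))
    where
      h : Q * tx + ρ ≤ Q * ty + (k + k) + ρ
      h = subst₂ _≤_ ex (trans (cong (_+ (k + k)) ey) (rearrange (Q * ty) ρ (k + k))) xy
        where rearrange : ∀ a b c → a + b + c ≡ a + c + b
              rearrange = solve-∀
      tx≤ty : tx ≤ ty
      tx≤ty = Q*-≤-cancel (+-cancelʳ-≤ ρ _ _ h) 2k<Q
  near-symbols-distinct {x} {y} yx xy dx@(falling tx ρ _ _ ex) dy@(falling ty _ _ _ ey) c with ≡symbol⇒≡height dx dy c
  ... | refl = <⇒≱ (+-monoˡ-< ρ yx) (subst₂ _≤_ (sym ex) (sym ey) (*-monoʳ-≤ Q (s≤s tx≤ty)))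
    where
      h : Q * suc tx ≤ Q * suc ty + (k + k)
      h = subst₂ _≤_ ex (trans (rearrange y ρ (k + k)) (cong (_+ (k + k)) ey)) (+-monoˡ-≤ ρ xy)
        where rearrange : ∀ a b c → a + c + b ≡ a + b + c
              rearrange = solve-∀
      tx≤ty : tx ≤ ty
      tx≤ty = ≤-pred (Q*-≤-cancel h 2k<Q)
  near-symbols-distinct {x} {y} yx xy dx@(rising tx ρ lρ ex) dy@(falling ty _ 1ρ′ _ ey) c with
      ≡symbol⇒≡height dx dy c
  ... | refl with ≤-antisym tx≤1+ty 1+ty≤tx
    where
      rearrange₁ : ∀ a b c → a + b + b ≡ a + (b + b)
      rearrange₁ = solve-∀
      h1 : Q * tx + (ρ + ρ) ≤ Q * suc ty + (k + k)
      h1 = subst₂ _≤_ (trans (cong (_+ ρ) ex) (rearrange₁ (Q * tx) ρ ρ))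
          (trans (rearrange₂ y (k + k) ρ) (cong (_+ (k + k)) ey)) (+-monoˡ-≤ ρ xy)
        where rearrange₂ : ∀ a b c → a + b + c ≡ a + c + b
              rearrange₂ = solve-∀
      tx≤1+ty : tx ≤ suc ty
      tx≤1+ty = Q*-≤-cancel (≤-trans (m≤m+n (Q * tx) (ρ + ρ)) h1) 2k<Q
      h2 : Q * suc ty ≤ Q * tx + (k + k)
      h2 = ≤-trans (≤-trans (≤-reflexive (sym ey)) (<⇒≤ (+-monoˡ-< ρ yx)))
          (≤-trans (≤-reflexive (trans (cong (_+ ρ) ex) (rearrange₁ (Q * tx) ρ ρ)))
          (+-monoʳ-≤ (Q * tx) (+-mono-≤ lρ lρ)))
      1+ty≤tx : suc ty ≤ tx
      1+ty≤tx = Q*-≤-cancel h2 2k<Q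
  ...   | refl = w-falling≢rising ty (sym (≡symbol⇒≡letter dx dy c 1ρ′))
  near-symbols-distinct {x} {y} yx xy dx@(falling tx ρ 1ρ lρ ex) dy@(rising ty _ _ ey) c with ≡symbol⇒≡height dx dy c
  ... | refl with ≤-antisym tx≤ty ty≤tx
    where
      tx≤ty : tx ≤ ty
      tx≤ty = Q*-≤-cancel (+-cancelʳ-≤ Q _ _ hA) 2k<Q
        where
          open ≤-Reasoning
          rearrange : ∀ a r k → a + r + k + r ≡ a + k + (r + r)
          rearrange = solve-∀
          hA : Q * tx + Q ≤ Q * ty + (k + k) + Q
          hA = begin
            Q * tx + Q ≡⟨ trans (+-comm (Q * tx) Q) (sym (*-suc Q tx)) ⟩
            Q * suc tx ≡⟨ sym ex ⟩
            x + ρ ≤⟨ +-monoˡ-≤ ρ xy ⟩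
            y + (k + k) + ρ ≡⟨ cong (λ z → z + (k + k) + ρ) ey ⟩
            Q * ty + ρ + (k + k) + ρ ≡⟨ rearrange (Q * ty) ρ (k + k) ⟩
            Q * ty + (k + k) + (ρ + ρ) ≤⟨ +-monoʳ-≤ (Q * ty + (k + k)) (≤-trans (+-mono-≤ lρ lρ) (n≤1+n _)) ⟩
            Q * ty + (k + k) + Q ∎
      ty≤tx : ty ≤ tx
      ty≤tx = ≤-pred (*-cancelˡ-< Q ty (suc tx)
          (≤-trans (s≤s (m≤m+n (Q * ty) ρ))
          (≤-trans (≤-reflexive (cong suc (sym ey))) (≤-trans yx (≤-trans (m≤m+n x ρ) (≤-reflexive ex))))))
  ...   | refl = w-rising≢falling tx (sym (≡symbol⇒≡letter dx dy c 1ρ))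

  step-above-separator : ∀ {x X} t → x ≡ Q * t + 0 → (d : Place X) → StepUp x X → halfBlock d ≡ t + t × 1 ≤ height d
  step-above-separator t e d@(rising _ _ _ _) (s , 1≤s , s≤k , m) with step d (rising t 0 z≤n e) m s≤k
  ... | refl , s≡ρ = refl , subst (1 ≤_) s≡ρ 1≤s
  step-above-separator t e d@(falling _ ρ _ ρ≤k _) (s , _ , s≤k , m) with step d (rising t 0 z≤n e) m s≤k
  ... | refl , ρ+s≡Q = ⊥-elim (+≢Q ρ≤k s≤k (trans (cong (_+ s) (sym (+-identityʳ ρ))) ρ+s≡Q))

  step-below-separator : ∀ {x X} t → x ≡ Q * t + 0 → (d : Place X) → StepUp X x →
                         ∃[ T ] (t ≡ suc T × halfBlock d ≡ suc (T + T) × 1 ≤ height d)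
  step-below-separator t e d@(rising _ ρ _ _) (s , 1≤s , s≤k , m) with step (rising t 0 z≤n e) d m s≤k
  ... | _ , ρ+s≡0 = ⊥-elim (<⇒≱ (≤-trans 1≤s (m≤n+m s ρ)) (≤-reflexive ρ+s≡0))
  step-below-separator t e d@(falling T _ 1≤ρ _ _) (s , _ , s≤k , m) with step (rising t 0 z≤n e) d m s≤k
  ... | t≡1+T , _ = T , t≡1+T , refl , 1≤ρ

  mirrored-same-slope⇒separators : ∀ {x y} (dx : Place x) (dy : Place y) → SameSlope dx dy → Mirrored dx dy →
                                   symbolAt dx ≡ symbolAt dy →
                                   Σ[ tx ∈ ℕ ] (x ≡ Q * tx + 0) × Σ[ ty ∈ ℕ ] (y ≡ Q * ty + 0)
  mirrored-same-slope⇒separators dx@(rising tx _ _ ex) dy@(rising ty _ _ ey) _ refl eq with ≡symbol⇒≡height dx dy eq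
  ... | refl = tx , ex , ty , ey
  mirrored-same-slope⇒separators (rising _ _ _ _)    (falling _ _ _ _ _) () _ _
  mirrored-same-slope⇒separators (falling _ _ _ _ _) (rising _ _ _ _)    () _ _
  mirrored-same-slope⇒separators (falling _ _ _ _ _) (falling _ _ _ _ _) _ () _

  SameSymbol : ℕ → ℕ → Set
  SameSymbol x y = symbol x ≡ symbol y

  same-letter : ∀ x y {β β′} → halfBlock (place x) ≡ β → halfBlock (place y) ≡ β′ → 1 ≤ height (place x) →
                SameSymbol x y → w β ≡ w β′
  same-letter x y refl refl 1≤h eq = ≡symbol⇒≡letter (place x) (place y) eq 1≤h

  -- x and y are forced to be separators, and the letters of the neighbouring half-blocks give w (2T+1) ≡ w (2T+2).
  descent-valley-mismatch : ∀ {X₀ Y₀ x y X₂ Y₂} → StepUp x X₀ → StepUp y Y₀ → StepUp X₂ x → StepUp y Y₂ →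
                            SameSymbol X₀ Y₀ → SameSymbol x y → SameSymbol X₂ Y₂ → ⊥
  descent-valley-mismatch {X₀} {Y₀} {x} {y} {X₂} {Y₂} st₀ st₀′ st₂ st₂′ eq₀ eq eq₂
    with parallel-steps st₀ st₀′ (place X₀) (place Y₀) (place x) (place y) eq₀ eq
       | antiparallel-steps st₂ st₂′ (place x) (place y) (place X₂) (place Y₂) eq eq₂
  ... | _ , _ , sm | _ , op , _ with mirrored-same-slope⇒separators (place x) (place y) sm op eq
  ... | tx , ex , ty , ey with step-above-separator tx ex (place X₀) st₀ | step-above-separator ty ey (place Y₀) st₀′
                             | step-below-separator tx ex (place X₂) st₂ | step-above-separator ty ey (place Y₂) st₂′
  ... | β₀ , 1≤h₀ | β₀′ , _ | T , refl , β₂ , 1≤h₂ | β₂′ , _ =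
    w-falling≢rising T (trans (same-letter X₂ Y₂ β₂ β₂′ 1≤h₂ eq₂) (sym (same-letter X₀ Y₀ β₀ β₀′ 1≤h₀ eq₀)))

  valley-ascent-mismatch : ∀ {X₀ Y₀ x y X₂ Y₂} → StepUp x X₀ → StepUp Y₀ y → StepUp x X₂ → StepUp y Y₂ →
                           SameSymbol X₀ Y₀ → SameSymbol x y → SameSymbol X₂ Y₂ → ⊥
  valley-ascent-mismatch {X₀} {Y₀} {x} {y} {X₂} {Y₂} st₀ st₀′ st₂ st₂′ eq₀ eq eq₂
    with antiparallel-steps st₀ st₀′ (place X₀) (place Y₀) (place x) (place y) eq₀ eq
       | parallel-steps st₂ st₂′ (place X₂) (place Y₂) (place x) (place y) eq₂ eq
  ... | _ , _ , op | _ , _ , sm with mirrored-same-slope⇒separators (place x) (place y) sm op eq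
  ... | tx , ex , ty , ey with step-above-separator tx ex (place X₀) st₀ | step-below-separator ty ey (place Y₀) st₀′
                             | step-above-separator tx ex (place X₂) st₂ | step-above-separator ty ey (place Y₂) st₂′
  ... | β₀ , 1≤h₀ | T , refl , β₀′ , _ | β₂ , 1≤h₂ | β₂′ , _ =
    w-falling≢rising T (trans (sym (same-letter X₀ Y₀ β₀ β₀′ 1≤h₀ eq₀)) (same-letter X₂ Y₂ β₂ β₂′ 1≤h₂ eq₂))

  Q*-gap : ∀ a b D → Q * a + D ≡ Q * b → Σ[ L ∈ ℕ ] (D ≡ Q * L × b ≡ a + L)
  Q*-gap a b D e = b ∸ a , D≡QL , b≡a+L
    where
      b≡a+L : b ≡ a + (b ∸ a)
      b≡a+L = sym (m+[n∸m]≡n (*-cancelˡ-≤ Q (≤-trans (m≤m+n (Q * a) D) (≤-reflexive e))))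
      D≡QL : D ≡ Q * (b ∸ a)
      D≡QL = +-cancelˡ-≡ (Q * a) _ _ (trans e (trans (cong (Q *_) b≡a+L) (*-distribˡ-+ Q a (b ∸ a))))

  parallel-shift : ∀ {z u D} (dz : Place z) (du : Place u) → u + D ≡ z → SameSlope dz du → symbolAt dz ≡ symbolAt du →
                   Σ[ L ∈ ℕ ] (D ≡ Q * L × halfBlock dz ≡ halfBlock du + (L + L))
  parallel-shift {D = D} dz@(rising tz ρ _ ez) du@(rising tu _ _ eu) m _ eq with ≡symbol⇒≡height dz du eq
  ... | refl with Q*-gap tu tz D
      (+-cancelʳ-≡ ρ _ _ (trans (xy∙z≈xz∙y (Q * tu) D ρ) (trans (cong (_+ D) (sym eu)) (trans m ez))))
  ... | L , D≡QL , refl = L , D≡QL , rearrange tu L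
    where rearrange : ∀ a L → a + L + (a + L) ≡ a + a + (L + L)
          rearrange = solve-∀
  parallel-shift {u = u} {D} dz@(falling tz ρ _ _ ez) du@(falling tu _ _ _ eu) m _ eq with ≡symbol⇒≡height dz du eq
  ... | refl with Q*-gap (suc tu) (suc tz) D
      (trans (cong (_+ D) (sym eu)) (trans (xy∙z≈xz∙y u ρ D) (trans (cong (_+ ρ) m) ez)))
  ... | L , D≡QL , 1+tz≡1+tu+L with suc-injective 1+tz≡1+tu+L
  ... | refl = L , D≡QL , rearrange tu L
    where rearrange : ∀ a L → suc (a + L + (a + L)) ≡ suc (a + a) + (L + L)
          rearrange = solve-∀
  parallel-shift (rising _ _ _ _)    (falling _ _ _ _ _) _ () _
  parallel-shift (falling _ _ _ _ _) (rising _ _ _ _)    _ () _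

  rising-unique : ∀ {p t ρ} → 1 ≤ ρ → ρ ≤ k → p ≡ Q * t + ρ → (d : Place p) → halfBlock d ≡ t + t × 1 ≤ height d
  rising-unique {p} {t} {ρ} 1ρ ρk e (rising t′ ρ′ l′ e′) with quotRem-unique Q t′ t ρ′ ρ (≤k⇒<Q l′) (≤k⇒<Q ρk)
      (trans (sym e′) e)
  ... | refl , refl = refl , 1ρ
  rising-unique {p} {t} {ρ} 1ρ ρk e (falling t′ ρ′ _ l′ e′) = ⊥-elim (<⇒≱ (≤-trans 1ρ (m≤m+n ρ ρ′)) (≤-reflexive z))
    where
      eq : Q * t + (ρ + ρ′) ≡ Q * suc t′ + 0
      eq = trans (sym (+-assoc (Q * t) ρ ρ′)) (trans (cong (_+ ρ′) (sym e)) (trans e′ (sym (+-identityʳ _))))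
      z : ρ + ρ′ ≡ 0
      z = proj₂ (quotRem-unique Q t (suc t′) (ρ + ρ′) 0 (+<Q ρk l′) (s≤s z≤n) eq)

  falling-unique : ∀ {p t ρ} → 1 ≤ ρ → ρ ≤ k → p + ρ ≡ Q * suc t → (d : Place p) →
      halfBlock d ≡ suc (t + t) × 1 ≤ height d
  falling-unique {p} {t} {ρ} 1ρ ρk e (falling t′ ρ′ 1ρ′ l′ e′) with quotRem-unique Q (suc t′) (suc t) ρ ρ′
      (≤k⇒<Q ρk) (≤k⇒<Q l′) (trans (cong (_+ ρ) (sym e′)) (trans (rearrange p ρ′ ρ) (trans (cong (_+ ρ′) e) refl)))
    where rearrange : ∀ p a b → p + a + b ≡ p + b + a
          rearrange = solve-∀
  ... | refl , refl = refl , 1ρ′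
  falling-unique {p} {t} {ρ} 1ρ ρk e (rising t′ ρ′ l′ e′) = ⊥-elim (<⇒≱ (≤-trans 1ρ (m≤n+m ρ ρ′)) (≤-reflexive z))
    where
      eq : Q * t′ + (ρ′ + ρ) ≡ Q * suc t + 0
      eq = trans (sym (+-assoc (Q * t′) ρ′ ρ)) (trans (cong (_+ ρ) (sym e′)) (trans e (sym (+-identityʳ _))))
      z : ρ′ + ρ ≡ 0
      z = proj₂ (quotRem-unique Q t′ (suc t) (ρ′ + ρ) 0 (+<Q l′ ρk) (s≤s z≤n) eq)

  -- Two copies of a descending walk, the second shifted down by D, force D = Q L with w (β + 2L) ≡ w β
  -- for every half-block β the walk passes through; these are 2L consecutive half-blocks, a square in w.
  module ParallelDescent (i i′ : ℕ → ℕ) (r D : ℕ) (1≤r : 1 ≤ r)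
    (desc : ∀ j → 1 ≤ j → j < r → i (suc j) < i j × i j ≤ i (suc j) + k)
    (shifted : ∀ j → 1 ≤ j → j ≤ r → i′ j + D ≡ i j)
    (same-slope : ∀ j → 1 ≤ j → j ≤ r → SameSlope (place (i j)) (place (i′ j)))
    (same : ∀ j → 1 ≤ j → j ≤ r → SameSymbol (i j) (i′ j))
    (shift-below-end : i′ 1 < i r) (end-near-shift : i r ≤ i′ 1 + k) where

    first-pair = parallel-shift (place (i 1)) (place (i′ 1)) (shifted 1 ≤-refl 1≤r) (same-slope 1 ≤-refl 1≤r)
        (same 1 ≤-refl 1≤r)
    L : ℕ
    L = proj₁ first-pair
    D≡QL : D ≡ Q * L
    D≡QL = proj₁ (proj₂ first-pair)

    halfBlock-shift : ∀ j → 1 ≤ j → j ≤ r → halfBlock (place (i j)) ≡ halfBlock (place (i′ j)) + (L + L)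
    halfBlock-shift j 1≤j j≤r with parallel-shift (place (i j)) (place (i′ j)) (shifted j 1≤j j≤r)
        (same-slope j 1≤j j≤r) (same j 1≤j j≤r)
    ... | Lj , DLj , e with *-cancelˡ-≡ Lj L Q (trans (sym DLj) D≡QL)
    ...   | refl = e

    end+shift≤start+k : i r + Q * L ≤ i 1 + k
    end+shift≤start+k = subst₂ _≤_ refl
        (trans (rearrange (i′ 1) k (Q * L)) (cong (_+ k) (trans (cong (i′ 1 +_) (sym D≡QL)) (shifted 1 ≤-refl 1≤r))))
        (+-monoˡ-≤ (Q * L) end-near-shift)
      where rearrange : ∀ a b c → a + b + c ≡ a + c + b
            rearrange = solve-∀

    visits : ∀ c → c ≤ i 1 → i r < c + k → Σ ℕ λ j → 1 ≤ j × j ≤ r × c ≤ i j × i j < c + k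
    visits c c≤start end<c+k with descent-hits-window k i 1 (r ∸ 1) c desc′ c≤start
        (subst (λ q → i q < c + k) (sym 1+[r∸1]≡r) end<c+k)
      where
        1+[r∸1]≡r : 1 + (r ∸ 1) ≡ r
        1+[r∸1]≡r = m+[n∸m]≡n 1≤r
        desc′ : ∀ j → 1 ≤ j → j < 1 + (r ∸ 1) → i (suc j) < i j × i j ≤ i (suc j) + k
        desc′ j 1≤j j<r = desc j 1≤j (subst (j <_) 1+[r∸1]≡r j<r)
    ... | j , 1≤j , j≤r , lo , hi = j , 1≤j , subst (j ≤_) (m+[n∸m]≡n 1≤r) j≤r , lo , hi

    letter-repeats : ∀ j → 1 ≤ j → j ≤ r → ∀ B → halfBlock (place (i j)) ≡ B + (L + L) →
        1 ≤ height (place (i j)) → w (B + (L + L)) ≡ w B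
    letter-repeats j 1≤j j≤r B eB 1ρ = trans (cong w (sym eB))
        (trans (≡symbol⇒≡letter (place (i j)) (place (i′ j)) (same j 1≤j j≤r) 1ρ)
        (cong w (+-cancelʳ-≡ (L + L) _ _ (trans (sym (halfBlock-shift j 1≤j j≤r)) eB))))

    rising-letter-repeats : ∀ T → Q * (T + L) + 1 ≤ i 1 → i r < Q * (T + L) + 1 + k → w ((T + L) + (T + L)) ≡ w (T + T)
    rising-letter-repeats T lo hi with visits (Q * (T + L) + 1) lo hi
    ... | j , 1≤j , j≤r , lo , hi with rising-unique {i j} {T + L} {i j ∸ Q * (T + L)} 1ρ ρk (sym (m+[n∸m]≡n QX≤ij))
        (place (i j))
      where
        QX≤ij : Q * (T + L) ≤ i j
        QX≤ij = ≤-trans (m≤m+n _ 1) lo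
        1ρ : 1 ≤ i j ∸ Q * (T + L)
        1ρ = subst (_≤ i j ∸ Q * (T + L)) (m+n∸m≡n (Q * (T + L)) 1) (∸-monoˡ-≤ (Q * (T + L)) lo)
        ρk : i j ∸ Q * (T + L) ≤ k
        ρk = ≤-pred (subst (i j ∸ Q * (T + L) <_)
            (trans (cong (_∸ Q * (T + L)) (+-assoc (Q * (T + L)) 1 k)) (m+n∸m≡n (Q * (T + L)) (suc k)))
            (∸-monoˡ-< hi QX≤ij))
    ... | eβ , 1ρ′ = subst (λ q → w q ≡ w (T + T)) (sym (rearrange T L))
        (letter-repeats j 1≤j j≤r (T + T) (trans eβ (rearrange T L)) 1ρ′)
      where rearrange : ∀ T L → T + L + (T + L) ≡ T + T + (L + L)
            rearrange = solve-∀

    falling-letter-repeats : ∀ T → Q * (T + L) + suc k ≤ i 1 → i r < Q * (T + L) + suc k + k →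
        w (suc ((T + L) + (T + L))) ≡ w (suc (T + T))
    falling-letter-repeats T lo hi with visits (Q * (T + L) + suc k) lo hi
    ... | j , 1≤j , j≤r , lo , hi with falling-unique {i j} {T + L} {Q * suc (T + L) ∸ i j} 1ρ ρk
        (m+[n∸m]≡n (<⇒≤ hi′)) (place (i j))
      where
        X = T + L
        eQ : Q * X + suc k + k ≡ Q * suc X
        eQ = trans (+-assoc (Q * X) (suc k) k) (sym (Q*-suc X))
        hi′ : i j < Q * suc X
        hi′ = subst (i j <_) eQ hi
        1ρ : 1 ≤ Q * suc X ∸ i j
        1ρ = m<n⇒0<n∸m hi′
        ρk : Q * suc X ∸ i j ≤ k
        ρk = ≤-trans (∸-monoʳ-≤ (Q * suc X) lo)
            (≤-reflexive (trans (cong (_∸ (Q * X + suc k)) (sym eQ)) (m+n∸m≡n (Q * X + suc k) k)))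
    ... | eβ , 1ρ′ = subst (λ q → w q ≡ w (suc (T + T))) (sym (rearrange T L))
        (letter-repeats j 1≤j j≤r (suc (T + T)) (trans eβ (rearrange T L)) 1ρ′)
      where rearrange : ∀ T L → suc (T + L + (T + L)) ≡ suc (T + T) + (L + L)
            rearrange = solve-∀

    desc-mono : ∀ n → 1 + n ≤ r → i (1 + n) ≤ i 1
    desc-mono zero _ = ≤-refl
    desc-mono (suc n) le = ≤-trans (<⇒≤ (proj₁ (desc (1 + n) (s≤s z≤n) le))) (desc-mono n (≤-trans (n≤1+n _) le))

    end≤start : i r ≤ i 1
    end≤start = subst (λ q → i q ≤ i 1) (m+[n∸m]≡n 1≤r) (desc-mono (r ∸ 1) (≤-reflexive (m+[n∸m]≡n 1≤r)))

    1≤L : 1 ≤ L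
    1≤L with L | D≡QL
    ... | zero | e = ⊥-elim
        (<⇒≱ shift-below-end (≤-trans end≤start
        (≤-reflexive (trans (sym (shifted 1 ≤-refl 1≤r))
        (trans (cong (i′ 1 +_) (trans e (*-zeroʳ Q))) (+-identityʳ _))))))
    ... | suc _ | _ = s≤s z≤n

    half< : ∀ v → v + v < L + L → v < L
    half< v lt with v <? L
    ... | yes p = p
    ... | no np = ⊥-elim (<⇒≱ lt (+-mono-≤ (≮⇒≥ np) (≮⇒≥ np)))

    half<′ : ∀ v → suc (v + v) < L + L → suc v ≤ L
    half<′ v lt with suc v ≤? L
    ... | yes p = p
    ... | no np = ⊥-elim (<⇒≱ lt (≤-trans (+-mono-≤ (≤-pred (≰⇒> np)) (≤-pred (≰⇒> np))) (n≤1+n _)))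

    falling-top : ∀ X → Q * X + suc k + k ≡ Q * suc X
    falling-top X = trans (+-assoc (Q * X) (suc k) k) (sym (Q*-suc X))

    absurd-if-end-rising : ∀ t₀ ρ₀ → ρ₀ ≤ k → i r ≡ Q * (t₀ + L) + ρ₀ → ⊥
    absurd-if-end-rising t₀ ρ₀ ρ₀≤k e₀ = w-squareFree (t₀ + t₀) (L + L) (≤-trans 1≤L (m≤m+n L L)) square
      where
        blocks-below-start : Q * (t₀ + L) + Q * L ≤ i 1 + k
        blocks-below-start = ≤-trans (+-monoˡ-≤ (Q * L) (≤-trans (m≤m+n _ ρ₀) (≤-reflexive (sym e₀)))) end+shift≤start+k
        block-below-start : ∀ v → v < L → Q * suc (t₀ + v + L) ≤ i 1 + k
        block-below-start v v<L = ≤-trans (*-monoʳ-≤ Q le)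
            (≤-trans (≤-reflexive (*-distribˡ-+ Q (t₀ + L) L)) blocks-below-start)
          where le : suc (t₀ + v + L) ≤ t₀ + L + L
                le = subst₂ _≤_ (rearrange t₀ v L) refl (+-monoˡ-≤ L (+-monoʳ-≤ t₀ v<L))
                  where rearrange : ∀ s v L → s + suc v + L ≡ suc (s + v + L)
                        rearrange = solve-∀
        end-in-block : ∀ v → i r ≤ Q * (t₀ + v + L) + k
        end-in-block v = ≤-trans (≤-reflexive e₀) (+-mono-≤ (*-monoʳ-≤ Q (+-monoˡ-≤ L (m≤m+n t₀ v))) ρ₀≤k)
        square : ∀ q → q < L + L → w (t₀ + t₀ + q) ≡ w (t₀ + t₀ + (L + L) + q)
        square q lt with even⊎odd q
        ... | v , inj₁ refl = sym
            (subst₂ (λ a b → w a ≡ w b) (index-shift t₀ v L) (index-split t₀ v)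
            (rising-letter-repeats (t₀ + v) lo hi))
          where
            v<L = half< v lt
            index-shift : ∀ s v L → s + v + L + (s + v + L) ≡ s + s + (L + L) + (v + v)
            index-shift = solve-∀
            index-split : ∀ s v → s + v + (s + v) ≡ s + s + (v + v)
            index-split = solve-∀
            lo : Q * (t₀ + v + L) + 1 ≤ i 1
            lo = +-cancelʳ-≤ k _ _
                (≤-trans (≤-trans (≤-reflexive (+-assoc _ 1 k))
                (+-monoʳ-≤ (Q * (t₀ + v + L)) (s≤s (m≤m+n k k))))
                (≤-trans (≤-reflexive (sym (Q*-suc (t₀ + v + L)))) (block-below-start v v<L)))
            hi : i r < Q * (t₀ + v + L) + 1 + k
            hi = ≤-trans (s≤s (end-in-block v)) (≤-reflexive (trans (sym (+-suc _ k)) (sym (+-assoc _ 1 k))))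
        ... | v , inj₂ refl = sym
            (subst₂ (λ a b → w a ≡ w b) (index-shift t₀ v L) (index-split t₀ v)
            (falling-letter-repeats (t₀ + v) lo hi))
          where
            v<L = ≤-trans (n≤1+n _) (half<′ v lt)
            index-shift : ∀ s v L → suc (s + v + L + (s + v + L)) ≡ s + s + (L + L) + suc (v + v)
            index-shift = solve-∀
            index-split : ∀ s v → suc (s + v + (s + v)) ≡ s + s + suc (v + v)
            index-split = solve-∀
            lo : Q * (t₀ + v + L) + suc k ≤ i 1
            lo = +-cancelʳ-≤ k _ _
                (≤-trans (≤-reflexive (falling-top (t₀ + v + L)))
                (block-below-start v (half< v (≤-trans (n≤1+n _) lt))))
            hi : i r < Q * (t₀ + v + L) + suc k + k
            hi = ≤-trans (s≤s (end-in-block v)) (≤-trans (≤-reflexive (sym (+-suc _ k))) (m≤m+n _ k))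

    absurd-if-end-falling : ∀ t₀ ρ₀ → 1 ≤ ρ₀ → ρ₀ ≤ k → i r + ρ₀ ≡ Q * suc (t₀ + L) → ⊥
    absurd-if-end-falling t₀ ρ₀ 1≤ρ₀ ρ₀≤k e₀ = w-squareFree (suc (t₀ + t₀)) (L + L) (≤-trans 1≤L (m≤m+n L L)) square
      where
        open ≤-Reasoning
        blocks-below-start : Q * (t₀ + L + L) + 1 ≤ i 1
        blocks-below-start = +-cancelʳ-≤ (k + k) _ _ (begin
          Q * (t₀ + L + L) + 1 + (k + k) ≡⟨ shift k (t₀ + L) L ⟩
          Q * suc (t₀ + L) + Q * L ≡⟨ cong (_+ Q * L) (sym e₀) ⟩
          i r + ρ₀ + Q * L ≡⟨ rearrange (i r) ρ₀ (Q * L) ⟩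
          i r + Q * L + ρ₀ ≤⟨ +-mono-≤ end+shift≤start+k ρ₀≤k ⟩
          i 1 + k + k ≡⟨ +-assoc (i 1) k k ⟩
          i 1 + (k + k) ∎)
          where rearrange : ∀ a b c → a + b + c ≡ a + c + b
                rearrange = solve-∀
                shift : ∀ k t L → suc (k + k) * (t + L) + 1 + (k + k) ≡ suc (k + k) * suc t + suc (k + k) * L
                shift = solve-∀
        end-below-block : i r < Q * suc (t₀ + L)
        end-below-block = <-≤-trans (m<m+n (i r) 1≤ρ₀) (≤-reflexive e₀)
        square : ∀ q → q < L + L → w (suc (t₀ + t₀) + q) ≡ w (suc (t₀ + t₀) + (L + L) + q)
        square q lt with even⊎odd q
        ... | v , inj₁ refl = sym
            (subst₂ (λ a b → w a ≡ w b) (index-shift t₀ v L) (index-split t₀ v)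
            (falling-letter-repeats (t₀ + v) lo hi))
          where
            v<L = half< v lt
            index-shift : ∀ s v L → suc (s + v + L + (s + v + L)) ≡ suc (s + s) + (L + L) + (v + v)
            index-shift = solve-∀
            index-split : ∀ s v → suc (s + v + (s + v)) ≡ suc (s + s) + (v + v)
            index-split = solve-∀
            le : suc (t₀ + v + L) ≤ t₀ + L + L
            le = subst₂ _≤_ (rearrange t₀ v L) refl (+-monoˡ-≤ L (+-monoʳ-≤ t₀ v<L))
              where rearrange : ∀ s v L → s + suc v + L ≡ suc (s + v + L)
                    rearrange = solve-∀
            lo : Q * (t₀ + v + L) + suc k ≤ i 1
            lo = ≤-trans (+-monoʳ-≤ (Q * (t₀ + v + L)) (s≤s (m≤m+n k k)))
                (≤-trans (≤-reflexive (sym (Q*-suc (t₀ + v + L))))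
                (≤-trans (*-monoʳ-≤ Q le) (≤-trans (m≤m+n _ 1) blocks-below-start)))
            hi : i r < Q * (t₀ + v + L) + suc k + k
            hi = ≤-trans end-below-block
                (≤-trans (*-monoʳ-≤ Q (s≤s (+-monoˡ-≤ L (m≤m+n t₀ v))))
                (≤-reflexive (sym (falling-top (t₀ + v + L)))))
        ... | v , inj₂ refl = sym
            (subst₂ (λ a b → w a ≡ w b) (index-shift t₀ v L) (index-split t₀ v)
            (rising-letter-repeats (suc (t₀ + v)) lo hi))
          where
            v<L = half<′ v lt
            index-shift : ∀ s v L → suc (s + v) + L + (suc (s + v) + L) ≡ suc (s + s) + (L + L) + suc (v + v)
            index-shift = solve-∀
            index-split : ∀ s v → suc (s + v) + suc (s + v) ≡ suc (s + s) + suc (v + v)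
            index-split = solve-∀
            le : suc (t₀ + v) + L ≤ t₀ + L + L
            le = subst₂ _≤_ (rearrange t₀ v L) refl (+-monoˡ-≤ L (+-monoʳ-≤ t₀ v<L))
              where rearrange : ∀ s v L → s + suc v + L ≡ suc (s + v) + L
                    rearrange = solve-∀
            lo : Q * (suc (t₀ + v) + L) + 1 ≤ i 1
            lo = ≤-trans (+-monoˡ-≤ 1 (*-monoʳ-≤ Q le)) blocks-below-start
            hi : i r < Q * (suc (t₀ + v) + L) + 1 + k
            hi = ≤-trans end-below-block
                (≤-trans (*-monoʳ-≤ Q (s≤s (+-monoˡ-≤ L (m≤m+n t₀ v))))
                (≤-trans (m≤m+n _ (1 + k)) (≤-reflexive (sym (+-assoc (Q * (suc (t₀ + v) + L)) 1 k)))))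

    absurd : ⊥
    absurd with place (i r) | place (i′ r) | halfBlock-shift r 1≤r ≤-refl | same-slope r 1≤r ≤-refl
    ... | rising _ ρ₀ ρ₀≤k e₀ | rising tu _ _ _ | eβ | _ = absurd-if-end-rising tu ρ₀ ρ₀≤k
        (subst (λ t → i r ≡ Q * t + ρ₀) (double-injective (trans eβ (rearrange tu L))) e₀)
      where rearrange : ∀ a L → a + a + (L + L) ≡ (a + L) + (a + L)
            rearrange = solve-∀
    ... | falling _ ρ₀ 1≤ρ₀ ρ₀≤k e₀ | falling tu _ _ _ _ | eβ | _ = absurd-if-end-falling tu ρ₀ 1≤ρ₀ ρ₀≤k
        (subst (λ t → i r + ρ₀ ≡ Q * suc t) (double-injective (suc-injective (trans eβ (rearrange tu L)))) e₀)
      where rearrange : ∀ a L → suc (a + a) + (L + L) ≡ suc ((a + L) + (a + L))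
            rearrange = solve-∀
    ... | rising _ _ _ _ | falling _ _ _ _ _ | _ | ()
    ... | falling _ _ _ _ _ | rising _ _ _ _ | _ | ()

  module BadWalk
    (i : ℕ → ℕ) (r m : ℕ) (1≤r : 1 ≤ r) (1<m : 1 < m) (m≤2r : m ≤ 2 * r)
    (same : ∀ j → 1 ≤ j → j ≤ r → SameSymbol (i j) (i (j + r)))
    (desc : ∀ j → 1 ≤ j → j < m → i j > i (suc j))
    (asc : ∀ j → m ≤ j → j < 2 * r → i j < i (suc j))
    (near : ∀ j → 1 ≤ j → j < 2 * r → (i j ≤ i (suc j) + k) × (i (suc j) ≤ i j + k))
    (first-ascent : m < 2 * r → i (suc m) < i m + k) where

    desc-step : ∀ j → 1 ≤ j → j < m → StepUp (i (suc j)) (i j)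
    desc-step j 1≤j j<m = stepUp (desc j 1≤j j<m) (proj₁ (near j 1≤j (<-≤-trans j<m m≤2r)))

    asc-step : ∀ j → m ≤ j → j < 2 * r → StepUp (i j) (i (suc j))
    asc-step j m≤j j<2r = stepUp (asc j m≤j j<2r) (proj₂ (near j (≤-trans (<⇒≤ 1<m) m≤j) j<2r))

    near-distinct : ∀ {x y} → y < x → x ≤ y + (k + k) → SameSymbol x y → ⊥
    near-distinct {x} {y} y<x x≤y+2k eq = near-symbols-distinct y<x x≤y+2k (place x) (place y) eq

    desc-mono : ∀ j n → 1 ≤ j → j + n ≤ m → i (j + n) ≤ i j
    desc-mono j zero    _   _   = ≤-reflexive (cong i (+-identityʳ j))
    desc-mono j (suc n) 1≤j j+n<m = ≤-trans
      (<⇒≤ (subst (λ q → i q < i (j + n)) (sym (+-suc j n)) (desc (j + n) (≤-trans 1≤j (m≤m+n j n)) j+n<m′)))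
      (desc-mono j n 1≤j (≤-trans (n≤1+n _) j+n<m′))
      where j+n<m′ = subst (_≤ m) (+-suc j n) j+n<m

    j+r<2r : ∀ {j} → j < r → j + r < 2 * r
    j+r<2r {j} j<r = subst (j + r <_) (sym (2*r≡r+r r)) (+-monoˡ-< r j<r)

    r≤2r : r ≤ 2 * r
    r≤2r = subst (r ≤_) (sym (2*r≡r+r r)) (m≤m+n r r)

    r<2r : r < 2 * r
    r<2r = subst (r <_) (sym (2*r≡r+r r)) (subst (_< r + r) (+-identityʳ r) (+-monoʳ-< r 1≤r))

    1+[r∸1]≡r : 1 + (r ∸ 1) ≡ r
    1+[r∸1]≡r = m+[n∸m]≡n 1≤r

    middle≤start : r ≤ m → i r ≤ i 1
    middle≤start r≤m = subst (λ q → i q ≤ i 1) 1+[r∸1]≡r (desc-mono 1 (r ∸ 1) ≤-refl (subst (_≤ m) (sym 1+[r∸1]≡r) r≤m))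

    antiparallel-lockstep : ∀ j → 1 ≤ j → j < r → j < m → m ≤ j + r →
                            Σ[ s ∈ ℕ ] (1 ≤ s × s ≤ k × i (suc j) + s ≡ i j × i (j + r) + s ≡ i (suc j + r))
    antiparallel-lockstep j 1≤j j<r j<m m≤j+r = lock st₁ st₂ (proj₁ (antiparallel-steps st₁ st₂
      (place (i j)) (place (i (j + r))) (place (i (suc j))) (place (i (suc j + r))) (same j 1≤j (<⇒≤ j<r))
          (same (suc j) (s≤s z≤n) j<r)))
      where
        st₁ = desc-step j 1≤j j<m
        st₂ = asc-step (j + r) m≤j+r (j+r<2r j<r)
        lock : (st₁ : StepUp (i (suc j)) (i j)) (st₂ : StepUp (i (j + r)) (i (suc j + r))) → proj₁ st₁ ≡ proj₁ st₂ →
               Σ[ s ∈ ℕ ] (1 ≤ s × s ≤ k × i (suc j) + s ≡ i j × i (j + r) + s ≡ i (suc j + r))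
        lock (s , 1≤s , s≤k , down) (_ , _ , _ , up) refl = s , 1≤s , s≤k , down , up

    crossing-absurd : (∀ j → 1 ≤ j → j < r → j < m × m ≤ j + r) → i (1 + r) < i 1 → i r ≤ i (r + r) → ⊥
    crossing-absurd in-range start end
      with walks-cross k i (λ j → i (j + r)) 1 (r ∸ 1) lockstep start
                       (subst (λ q → i q ≤ i (q + r)) (sym 1+[r∸1]≡r) end)
      where
        lockstep : ∀ j → 1 ≤ j → j < 1 + (r ∸ 1) → Σ[ s ∈ ℕ ]
            (s ≤ k × i (suc j) + s ≡ i j × i (j + r) + s ≡ i (suc j + r))
        lockstep j 1≤j j<r with in-range j 1≤j (subst (j <_) 1+[r∸1]≡r j<r)
        ... | j<m , m≤j+r = map₂ proj₂ (antiparallel-lockstep j 1≤j (subst (j <_) 1+[r∸1]≡r j<r) j<m m≤j+r)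
    ... | j , 1≤j , j≤r , lt , le = near-distinct lt le (same j 1≤j (subst (j ≤_) 1+[r∸1]≡r j≤r))

    module NoTurn (m≡2r : m ≡ 2 * r) where
      <2r⇒<m : ∀ {j} → j < 2 * r → j < m
      <2r⇒<m = subst (_ <_) (sym m≡2r)

      parallel-lockstep : ∀ j → 1 ≤ j → j < r →
        (Σ[ s ∈ ℕ ] (i (suc j) + s ≡ i j × i (suc j + r) + s ≡ i (j + r))) ×
        SameSlope (place (i j)) (place (i (j + r))) × SameSlope (place (i (suc j))) (place (i (suc j + r)))
      parallel-lockstep j 1≤j j<r = lock st₁ st₂ (proj₁ steps) , proj₂ steps
        where
          st₁ = desc-step j 1≤j (<2r⇒<m (<-≤-trans j<r r≤2r))
          st₂ = desc-step (j + r) (≤-trans 1≤j (m≤m+n j r)) (<2r⇒<m (j+r<2r j<r))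
          steps = parallel-steps st₁ st₂ (place (i j)) (place (i (j + r))) (place (i (suc j))) (place (i (suc j + r)))
                                 (same j 1≤j (<⇒≤ j<r)) (same (suc j) (s≤s z≤n) j<r)
          lock : (st₁ : StepUp (i (suc j)) (i j)) (st₂ : StepUp (i (suc j + r)) (i (j + r))) → proj₁ st₁ ≡ proj₁ st₂ →
                 Σ[ s ∈ ℕ ] (i (suc j) + s ≡ i j × i (suc j + r) + s ≡ i (j + r))
          lock (s , _ , _ , down) (_ , _ , _ , down′) refl = s , down , down′

      D = i 1 ∸ i (1 + r)

      shift-by-D : ∀ n → suc n ≤ r → i (suc n + r) + D ≡ i (suc n)
      shift-by-D zero    _ = m+[n∸m]≡n
          (desc-mono 1 r ≤-refl
          (subst (1 + r ≤_) (sym m≡2r) (subst (1 + r ≤_) (sym (2*r≡r+r r)) (+-monoˡ-≤ r 1≤r))))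
      shift-by-D (suc n) n<r with parallel-lockstep (suc n) (s≤s z≤n) n<r
      ... | (s , down , down′) , _ = +-cancelʳ-≡ s _ _ (begin
            i (suc (suc n) + r) + D + s ≡⟨ xy∙z≈xz∙y (i (suc (suc n) + r)) D s ⟩
            i (suc (suc n) + r) + s + D ≡⟨ cong (_+ D) down′ ⟩
            i (suc n + r) + D           ≡⟨ shift-by-D n (≤-trans (n≤1+n _) n<r) ⟩
            i (suc n)                   ≡⟨ sym down ⟩
            i (suc (suc n)) + s         ∎)
        where open ≡-Reasoning

      same-slopes : 2 ≤ r → ∀ j → 1 ≤ j → j ≤ r → SameSlope (place (i j)) (place (i (j + r)))
      same-slopes 2≤r j 1≤j j≤r with j <? r
      ... | yes j<r = proj₁ (proj₂ (parallel-lockstep j 1≤j j<r))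
      ... | no  j≮r = subst (λ q → SameSlope (place (i q)) (place (i (q + r))))
          (trans 1+[r∸1]≡r (≤-antisym (≮⇒≥ j≮r) j≤r))
                        (proj₂ (proj₂ (parallel-lockstep (r ∸ 1) (∸-monoˡ-≤ 1 2≤r)
                            (subst (r ∸ 1 <_) 1+[r∸1]≡r ≤-refl))))

      absurd : ⊥
      absurd with 2 ≤? r
      ... | yes 2≤r = ParallelDescent.absurd i (λ j → i (j + r)) r D 1≤r descends shifted (same-slopes 2≤r) same
                        (desc r 1≤r (<2r⇒<m r<2r)) (proj₁ (near r 1≤r r<2r))
        where
          descends : ∀ j → 1 ≤ j → j < r → i (suc j) < i j × i j ≤ i (suc j) + k
          descends j 1≤j j<r = desc j 1≤j (<2r⇒<m (<-≤-trans j<r r≤2r)) , proj₁ (near j 1≤j (<-≤-trans j<r r≤2r))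
          shifted : ∀ j → 1 ≤ j → j ≤ r → i (j + r) + D ≡ i j
          shifted (suc n) _ n<r = shift-by-D n n<r
      ... | no  2≰r = near-distinct (subst (λ q → i (suc q) < i 1) (sym r≡1) (desc 1 ≤-refl 1<m))
                        (subst (λ q → i 1 ≤ i (suc q) + (k + k)) (sym r≡1)
                          (≤-trans (proj₁ (near 1 ≤-refl (<-≤-trans 1<m m≤2r))) (+-monoʳ-≤ (i 2) (m≤m+n k k))))
                        (same 1 ≤-refl 1≤r)
        where r≡1 = ≤-antisym (≤-pred (≰⇒> 2≰r)) 1≤r

    module LateTurn (r<m : r < m) (m<2r : m < 2 * r) where
      d = m ∸ r
      d+r≡m : d + r ≡ m
      d+r≡m = m∸n+n≡m (<⇒≤ r<m)
      1≤d : 1 ≤ d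
      1≤d = m<n⇒0<n∸m r<m
      d<r : d < r
      d<r = +-cancelʳ-< r d r (subst₂ _<_ (sym d+r≡m) (2*r≡r+r r) m<2r)

      turn-after-middle+1 : ∀ d′ → suc d′ ≡ d → 1 ≤ d′ → ⊥
      turn-after-middle+1 d′ 1+d′≡d 1≤d′ = descent-valley-mismatch
        (desc-step d′ 1≤d′ (≤-trans (m≤m+n (suc d′) r) (≤-reflexive d′+1+r≡m)))
        (desc-step (d′ + r) (≤-trans 1≤d′ (m≤m+n d′ r)) (≤-reflexive d′+1+r≡m))
        (desc-step (suc d′) (s≤s z≤n)
            (≤-trans (subst (_≤ suc d′ + r) (+-comm (suc d′) 1) (+-monoʳ-≤ (suc d′) 1≤r))
            (≤-reflexive d′+1+r≡m)))
        (asc-step (suc d′ + r) (≤-reflexive (sym d′+1+r≡m)) (j+r<2r 1+d′<r))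
        (same d′ 1≤d′ (≤-trans (n≤1+n _) (<⇒≤ 1+d′<r))) (same (suc d′) (s≤s z≤n) (<⇒≤ 1+d′<r))
            (same (suc (suc d′)) (s≤s z≤n) 1+d′<r)
        where
          1+d′<r : suc d′ < r
          1+d′<r = subst (_< r) (sym 1+d′≡d) d<r
          d′+1+r≡m : suc d′ + r ≡ m
          d′+1+r≡m = trans (cong (_+ r) 1+d′≡d) d+r≡m

      -- With m = r + 1 the sums i j + i (j + r) are all equal, so the two copies must cross.
      module TurnAfterMiddle (d≡1 : d ≡ 1) where
        1+r≡m : 1 + r ≡ m
        1+r≡m = trans (cong (_+ r) (sym d≡1)) d+r≡m

        in-range : ∀ j → 1 ≤ j → j < r → j < m × m ≤ j + r
        in-range j 1≤j j<r = <-trans j<r r<m , subst (_≤ j + r) 1+r≡m (+-monoˡ-≤ r 1≤j)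

        sum-constant : ∀ n → suc n ≤ r → i (suc n) + i (suc n + r) ≡ i 1 + i (1 + r)
        sum-constant zero    _   = refl
        sum-constant (suc n) n<r = step-sum
            (antiparallel-lockstep (suc n) (s≤s z≤n) n<r (proj₁ (in-range (suc n) (s≤s z≤n) n<r))
            (proj₂ (in-range (suc n) (s≤s z≤n) n<r)))
          where
            open ≡-Reasoning
            step-sum : Σ[ s ∈ ℕ ]
                (1 ≤ s × s ≤ k × i (suc (suc n)) + s ≡ i (suc n) × i (suc n + r) + s ≡ i (suc (suc n) + r)) →
                       i (suc (suc n)) + i (suc (suc n) + r) ≡ i 1 + i (1 + r)
            step-sum (s , _ , _ , down , up) = begin
              i (suc (suc n)) + i (suc (suc n) + r)  ≡⟨ cong (i (suc (suc n)) +_) (sym up) ⟩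
              i (suc (suc n)) + (i (suc n + r) + s)  ≡⟨ x∙yz≈xz∙y (i (suc (suc n))) (i (suc n + r)) s ⟩
              i (suc (suc n)) + s + i (suc n + r)    ≡⟨ cong (_+ i (suc n + r)) down ⟩
              i (suc n) + i (suc n + r)              ≡⟨ sum-constant n (≤-trans (n≤1+n _) n<r) ⟩
              i 1 + i (1 + r)                        ∎

        sum-at-r : i r + i (r + r) ≡ i 1 + i (1 + r)
        sum-at-r = subst (λ q → i q + i (q + r) ≡ i 1 + i (1 + r)) 1+[r∸1]≡r
            (sum-constant (r ∸ 1) (≤-reflexive 1+[r∸1]≡r))

        absurd : ⊥
        absurd with i (r + r) <? i r
        ... | yes end<mid = near-distinct end<mid mid≤end+2k (same r 1≤r ≤-refl)
          where
            i[1+r]≤i[r+r] : i (1 + r) ≤ i (r + r)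
            i[1+r]≤i[r+r] with i (r + r) <? i (1 + r)
            ... | yes lt = ⊥-elim (<⇒≢ (+-mono-≤-< (middle≤start (<⇒≤ r<m)) lt) sum-at-r)
            ... | no  ≮ = ≮⇒≥ ≮
            mid≤end+2k : i r ≤ i (r + r) + (k + k)
            mid≤end+2k with desc-step r 1≤r r<m
            ... | s , _ , s≤k , down = ≤-trans (≤-reflexive (sym down))
                (+-mono-≤ i[1+r]≤i[r+r] (≤-trans s≤k (m≤m+n k k)))
        ... | no  end≮mid = crossing-absurd in-range (<-≤-trans (desc r 1≤r r<m) (middle≤start (<⇒≤ r<m))) (≮⇒≥ end≮mid)

      absurd : ⊥
      absurd with 2 ≤? d
      ... | yes 2≤d = turn-after-middle+1 (d ∸ 1) (m+[n∸m]≡n 1≤d) (∸-monoˡ-≤ 1 2≤d)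
      ... | no  2≰d = TurnAfterMiddle.absurd (≤-antisym (≤-pred (≰⇒> 2≰d)) 1≤d)

    module EarlyTurn (m≤r : m ≤ r) where
      turn-before-middle : m < r → ⊥
      turn-before-middle m<r = valley-ascent-mismatch
        (desc-step m′ 1≤m′ (≤-reflexive 1+m′≡m))
        (asc-step (m′ + r) (≤-trans m≤r (m≤n+m r m′)) (j+r<2r (<-trans (n<1+n m′) 1+m′<r)))
        (asc-step (suc m′) (≤-reflexive (sym 1+m′≡m)) (<-≤-trans 1+m′<r r≤2r))
        (asc-step (suc m′ + r) (≤-trans (≤-reflexive (sym 1+m′≡m)) (m≤m+n (suc m′) r)) (j+r<2r 1+m′<r))
        (same m′ 1≤m′ (≤-trans (n≤1+n _) (≤-trans (≤-reflexive 1+m′≡m) m≤r)))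
        (same (suc m′) (s≤s z≤n) (≤-trans (≤-reflexive 1+m′≡m) m≤r))
        (same (suc (suc m′)) (s≤s z≤n) 1+m′<r)
        where
          m′ = m ∸ 1
          1+m′≡m : suc m′ ≡ m
          1+m′≡m = m+[n∸m]≡n (<⇒≤ 1<m)
          1≤m′ : 1 ≤ m′
          1≤m′ = ∸-monoˡ-≤ 1 1<m
          1+m′<r : suc m′ < r
          1+m′<r = subst (_< r) (sym 1+m′≡m) m<r

      module TurnAtMiddle (m≡r : m ≡ r) where
        in-range : ∀ j → 1 ≤ j → j < r → j < m × m ≤ j + r
        in-range j _ j<r = subst (j <_) (sym m≡r) j<r , subst (_≤ j + r) (sym m≡r) (m≤n+m r j)

        2≤r : 2 ≤ r
        2≤r = subst (2 ≤_) m≡r 1<m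

        absurd : ⊥
        absurd with <-cmp (i (1 + r)) (i 1)
        ... | tri< lt _ _ = crossing-absurd in-range lt (asc-mono r r (≤-reflexive m≡r) (≤-reflexive (sym (2*r≡r+r r))))
          where
            asc-mono : ∀ j n → m ≤ j → j + n ≤ 2 * r → i j ≤ i (j + n)
            asc-mono j zero    _   _ = ≤-reflexive (cong i (sym (+-identityʳ j)))
            asc-mono j (suc n) m≤j j+n<2r = ≤-trans (asc-mono j n m≤j (≤-trans (n≤1+n _) j+n<2r′))
              (<⇒≤ (subst (λ q → i (j + n) < i q) (sym (+-suc j n)) (asc (j + n) (≤-trans m≤j (m≤m+n j n)) j+n<2r′)))
              where j+n<2r′ = subst (_≤ 2 * r) (+-suc j n) j+n<2r
        ... | tri≈ _ eq _ = equal-starts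
            (antiparallel-lockstep 1 ≤-refl 2≤r (proj₁ (in-range 1 ≤-refl 2≤r)) (proj₂ (in-range 1 ≤-refl 2≤r)))
          where
            equal-starts : Σ[ s ∈ ℕ ] (1 ≤ s × s ≤ k × i 2 + s ≡ i 1 × i (1 + r) + s ≡ i (2 + r)) → ⊥
            equal-starts (s , 1≤s , s≤k , down , up) = near-distinct i2<i[2+r] i[2+r]≤i2+2k (sym (same 2 (s≤s z≤n) 2≤r))
              where
                open ≤-Reasoning
                i2<i[2+r] : i 2 < i (2 + r)
                i2<i[2+r] = begin-strict
                  i 2           <⟨ m<m+n (i 2) 1≤s ⟩
                  i 2 + s       ≡⟨ down ⟩
                  i 1           ≡⟨ sym eq ⟩
                  i (1 + r)     ≤⟨ m≤m+n _ s ⟩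
                  i (1 + r) + s ≡⟨ up ⟩
                  i (2 + r)     ∎
                i[2+r]≤i2+2k : i (2 + r) ≤ i 2 + (k + k)
                i[2+r]≤i2+2k = begin
                  i (2 + r)     ≡⟨ sym up ⟩
                  i (1 + r) + s ≡⟨ cong (_+ s) eq ⟩
                  i 1 + s       ≡⟨ cong (_+ s) (sym down) ⟩
                  i 2 + s + s   ≡⟨ +-assoc (i 2) s s ⟩
                  i 2 + (s + s) ≤⟨ +-monoʳ-≤ (i 2) (+-mono-≤ s≤k s≤k) ⟩
                  i 2 + (k + k) ∎
        absurd | tri> _ _ gt = near-distinct gt
            (≤-trans (<⇒≤ first-up) (+-mono-≤ (middle≤start (≤-reflexive (sym m≡r))) (m≤m+n k k)))
                                 (sym (same 1 ≤-refl 1≤r))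
          where
            first-up : i (suc r) < i r + k
            first-up = subst (λ q → i (suc q) < i q + k) m≡r (first-ascent (subst (_< 2 * r) (sym m≡r) r<2r))

      absurd : ⊥
      absurd with m <? r
      ... | yes m<r = turn-before-middle m<r
      ... | no  m≮r = TurnAtMiddle.absurd (≤-antisym m≤r (≮⇒≥ m≮r))

    absurd : ⊥
    absurd with m ≤? r
    ... | yes m≤r = EarlyTurn.absurd m≤r
    ... | no  m≰r with m <? 2 * r
    ...   | yes m<2r = LateTurn.absurd (≰⇒> m≰r) m<2r
    ...   | no  m≮2r = NoTurn.absurd (≤-antisym m≤2r (≮⇒≥ m≮2r))

  symbol<3k+1 : ∀ x → symbol x < 3 * k + 1
  symbol<3k+1 x = ≤-trans (s≤s (symbol≤3k x)) (≤-reflexive (+-comm 1 (3 * k)))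

  sequence : (n : ℕ) → Fin n → Fin (3 * k + 1)
  sequence n p = fromℕ< (symbol<3k+1 (toℕ p))

  sequence-kSpecial : ∀ n → KSpecial k (sequence n)
  sequence-kSpecial n (r , i , 1≤r , m , 1<m , m≤2r , same , desc , asc , near , first-ascent) =
    BadWalk.absurd (λ j → toℕ (i j)) r m 1≤r 1<m m≤2r same-symbol desc asc near first-ascent
    where
      same-symbol : ∀ j → 1 ≤ j → j ≤ r → SameSymbol (toℕ (i j)) (toℕ (i (j + r)))
      same-symbol j 1≤j j≤r = fromℕ<-injective _ _ (symbol<3k+1 (toℕ (i j))) (symbol<3k+1 (toℕ (i (j + r))))
          (same j 1≤j j≤r)

theorem8 : (k : ℕ) → 1 ≤ k → (N : ℕ) →
    ∃[ n ] (N ≤ n × ∃[ S ] KSpecial {Fin (3 * k + 1)} {n} k S)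
theorem8 k 1≤k N = N , ≤-refl , sequence N , sequence-kSpecial N
  where open Construction k 1≤k vtm vtm<3 vtm-squareFree
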